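{- Let $n\ge1$ and let $a,b,c\ge0$ be integers with $a+b+\binom{c+1}{2} \leq \binom{n}{2}$. Then there is at least one valley-marked parking function $MPF$ of size $n$ with $\operatorname{area}(MPF)=a$, $\operatorname{dinv}(MPF)=b$, and exactly $c$ marked valleys.
   Context: A Dyck path of size $n$ goes from $(0,0)$ to $(n,n)$ with unit North/East steps weakly above $y=x$; a parking function of size $n$ is such a path with $n$ distinct positive integer cars placed one in the cell immediately right of each North step, increasing upward in each column. The cell with lower-left corner $(i,j)$ lies in the $(j-i)$-diagonal; left/right for cars refers to columns. $\operatorname{area}$ is the number of full cells between the path and $y=x$. A valley is an East step immediately followed by a North step such that the cell directly below the East step has no car or has a car smaller than the car next to that North step. A valley-marked parking function is a parking function with a subset of its valleys marked; the car next to a marked valley's North step is marked. For cars $s<b$: a primary diagonal inversion occurs if $s,b$ are in the same diagonal, $s$ is to the left of $b$, and $s$ is unmarked; a secondary diagonal inversion occurs if $b$ is in the diagonal one above $s$'s, $b$ is to the left of $s$, and $b$ is unmarked. $\operatorname{dinv}$ is the number of primary and secondary diagonal inversions minus the number of marked valleys. -}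

module Defs where

open import Data.Nat using (ℕ; zero; suc; _+_; _∸_; _≤_; _<_; _<ᵇ_; _≡ᵇ_; pred)
open import Data.Bool using (Bool; true; false; _∧_; not; if_then_else_)
open import Data.List using (List; []; _∷_; take; map; allFin)
open import Data.Nat.ListAction using (sum)
open import Data.Fin using (Fin; toℕ)
open import Data.Fin.Subset using (Subset)
open import Data.Vec using (lookup)
open import Data.Integer using (ℤ; +_; _-_)
open import Data.Product using (_×_)
open import Function.Definitions using (Injective)
open import Relation.Binary.PropositionalEquality using (_≡_)

data Step : Set where
  N E : Step

countN : List Step → ℕ
countN []      = 0
countN (N ∷ s) = suc (countN s)
countN (E ∷ s) = countN s

countE : List Step → ℕ
countE []      = 0
countE (N ∷ s) = countE s
countE (E ∷ s) = suc (countE s)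

record IsDyck (n : ℕ) (p : List Step) : Set where
  field
    northCount : countN p ≡ n
    eastCount  : countE p ≡ n
    above      : ∀ k → countE (take k p) ≤ countN (take k p)

-- For each North step (in order, the k-th one going from row k to row k+1):
-- its x-coordinate (column), and whether it is immediately preceded by an
-- East step.
northCols' : ℕ → List Step → List ℕ
northCols' x []      = []
northCols' x (N ∷ s) = x ∷ northCols' x s
northCols' x (E ∷ s) = northCols' (suc x) s

northCols : List Step → List ℕ
northCols = northCols' 0

northPrevE' : Bool → List Step → List Bool
northPrevE' b []      = []
northPrevE' b (N ∷ s) = b ∷ northPrevE' false s
northPrevE' b (E ∷ s) = northPrevE' true s

northPrevE : List Step → List Bool
northPrevE = northPrevE' false

-- lookup with default (never used for well-formed Dyck paths of size n)
nth : List ℕ → ℕ → ℕ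
nth []       _       = 0
nth (x ∷ xs) zero    = x
nth (x ∷ xs) (suc k) = nth xs k

nthB : List Bool → ℕ → Bool
nthB []       _       = false
nthB (x ∷ xs) zero    = x
nthB (x ∷ xs) (suc k) = nthB xs k

-- area: row k contributes (k - column of k-th North step) full cells
areaFrom : ℕ → List ℕ → ℕ
areaFrom k []       = 0
areaFrom k (x ∷ xs) = (k ∸ x) + areaFrom (suc k) xs

-- Valley-marked parking functions of size n.
-- The car of the k-th North step (k : Fin n) sits in the cell with
-- lower-left corner (col k , k), which lies in the (k - col k)-diagonal.

record MPF (n : ℕ) : Set where
  field
    path   : List Step
    dyck   : IsDyck n path
    car    : Fin n → ℕ
    carPos : ∀ k → 0 < car k
    carInj : Injective _≡_ _≡_ car
    marked : Subset n

  col : Fin n → ℕ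
  col k = nth (northCols path) (toℕ k)

  diag : Fin n → ℕ
  diag k = toℕ k ∸ col k

  prevE : Fin n → Bool
  prevE k = nthB (northPrevE path) (toℕ k)

  -- The North step of row k is part of a valley: it is preceded by an East
  -- step and the cell directly below that East step (lower-left corner
  -- (col k - 1, k - 1)) has no car or a car smaller than car k.
  Valley : Fin n → Set
  Valley k = prevE k ≡ true
           × (∀ i → toℕ i ≡ pred (toℕ k) → col i ≡ pred (col k) → car i < car k)

  field
    colIncr : ∀ i j → toℕ j ≡ suc (toℕ i) → col j ≡ col i → car i < car j
    markedValley : ∀ k → lookup marked k ≡ true → Valley k

  isMarked : Fin n → Bool
  isMarked k = lookup marked k

open MPF public

ind : Bool → ℕ
ind b = if b then 1 else 0

countPairs : {n : ℕ} → (Fin n → Fin n → Bool) → ℕ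
countPairs {n} P = sum (map (λ i → sum (map (λ j → ind (P i j)) (allFin n))) (allFin n))

countFin : {n : ℕ} → (Fin n → Bool) → ℕ
countFin {n} P = sum (map (λ i → ind (P i)) (allFin n))

area : {n : ℕ} → MPF n → ℕ
area M = areaFrom 0 (northCols (path M))

numMarked : {n : ℕ} → MPF n → ℕ
numMarked M = countFin (isMarked M)

primary : {n : ℕ} → MPF n → ℕ
primary M = countPairs λ i j →
  (car M i <ᵇ car M j) ∧ (diag M i ≡ᵇ diag M j) ∧ (col M i <ᵇ col M j) ∧ not (isMarked M i)

secondary : {n : ℕ} → MPF n → ℕ
secondary M = countPairs λ i j →
  (car M i <ᵇ car M j) ∧ (diag M j ≡ᵇ suc (diag M i)) ∧ (col M j <ᵇ col M i) ∧ not (isMarked M j)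

dinv : {n : ℕ} → MPF n → ℤ
dinv M = + (primary M + secondary M) - + numMarked M

module Submission where

-- An MPF is described row by row: the diagonal of each row's North step,
-- the car beside it and whether it is marked ('Blueprint'); 'realize' turns
-- such data into an MPF whose area is the sum of the diagonals and whose
-- dinv plus marks counts inversions between pairs of rows.  We only build
-- MPFs made of a staircase of p rows followed by a tower of rows in
-- diagonals p and p + 1, with cars arranged in bands so that the inversions
-- a new top row forms depend only on its type and on the unmarked rows
-- below it ('profileOf', 'inversions-credit').  Greedy constructions of
-- towers ('stack-on', 'two-lanes') realize every inversion count from the
-- number of marks up to a capacity.  The theorem splits the area as
-- tri p + p·t + α ('area-split'), picks a tower shape whose capacity is
-- exactly the remaining budget ('choose-shape', 'capacity-fits'), and reads
-- off dinv = (b + c) - c = b.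

open import Defs
open import Data.Nat using (ℕ; zero; suc; _+_; _*_; _∸_; _≤_; _<_; _<ᵇ_; _≡ᵇ_; z≤n; s≤s; pred; _≤?_)
open import Data.Nat.Properties
open import Data.Nat.Tactic.RingSolver using (solve-∀)
open import Data.Bool using (Bool; true; false; _∧_; not; if_then_else_; T)
open import Data.Bool.Properties using (T-≡)
open import Data.Empty using (⊥; ⊥-elim)
open import Data.Unit using (⊤; tt)
open import Function.Base using (_∘_)
open import Function.Bundles using (Equivalence)
open import Relation.Nullary using (Dec; yes; no)
open import Data.List using (List; []; _∷_; _++_; take; map; allFin; length; replicate)
open import Data.List.Properties using (map-tabulate; ++-identityʳ)
open import Data.Nat.ListAction using (sum)
open import Data.Fin using (Fin; toℕ) renaming (zero to fzero; suc to fsuc)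
open import Data.Fin.Properties using (toℕ<n; toℕ-injective)
open import Data.Fin.Subset using (Subset)
open import Data.Vec using (tabulate; lookup)
open import Data.Vec.Properties using (lookup∘tabulate)
open import Data.Sum using (_⊎_; inj₁; inj₂)
open import Data.Nat.Combinatorics using (_C_; nC1≡n; nCk+nC[k+1]≡[n+1]C[k+1])
open import Data.Integer using (+_) renaming (_-_ to _-ℤ_)
import Data.Integer.Properties as ℤ
open import Data.Product using (Σ; _×_; _,_; proj₁; proj₂)
open import Relation.Binary.PropositionalEquality
open import Relation.Binary.Definitions using (tri<; tri≈; tri>)

-- ∑_{k < n} f k, peeled off from the bottom index (the order in which
-- 'allFin' enumerates).
sum< : ℕ → (ℕ → ℕ) → ℕ
sum< zero    f = 0
sum< (suc n) f = f 0 + sum< n (λ k → f (suc k))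

-- ∑_{i < j < n} X i j, grown by the pairs whose larger index is the new top
-- index: this is how a statistic changes when a row is added on top.
pairSum : ℕ → (ℕ → ℕ → ℕ) → ℕ
pairSum zero    X = 0
pairSum (suc n) X = pairSum n X + sum< n (λ i → X i n)

interchange : ∀ a b c d → (a + b) + (c + d) ≡ (a + c) + (b + d)
interchange = solve-∀

sum<-cong : ∀ n {f g : ℕ → ℕ} → (∀ k → k < n → f k ≡ g k) → sum< n f ≡ sum< n g
sum<-cong zero    eq = refl
sum<-cong (suc n) eq = cong₂ _+_ (eq 0 (s≤s z≤n)) (sum<-cong n (λ k k<n → eq (suc k) (s≤s k<n)))

sum<-zero : ∀ n (f : ℕ → ℕ) → (∀ k → k < n → f k ≡ 0) → sum< n f ≡ 0
sum<-zero zero    f eq = refl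
sum<-zero (suc n) f eq = cong₂ _+_ (eq 0 (s≤s z≤n)) (sum<-zero n _ (λ k k<n → eq (suc k) (s≤s k<n)))

sum<-snoc : ∀ n (f : ℕ → ℕ) → sum< (suc n) f ≡ sum< n f + f n
sum<-snoc zero    f = +-comm (f 0) 0
sum<-snoc (suc n) f = begin
  f 0 + sum< (suc n) (λ k → f (suc k))     ≡⟨ cong (_+_ (f 0)) (sum<-snoc n (λ k → f (suc k))) ⟩
  f 0 + (sum< n (λ k → f (suc k)) + f (suc n)) ≡⟨ +-assoc (f 0) _ _ ⟨
  f 0 + sum< n (λ k → f (suc k)) + f (suc n)   ∎
  where open ≡-Reasoning

sum<-+ : ∀ n (f g : ℕ → ℕ) → sum< n (λ k → f k + g k) ≡ sum< n f + sum< n g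
sum<-+ zero    f g = refl
sum<-+ (suc n) f g = trans (cong (_+_ (f 0 + g 0)) (sum<-+ n _ _)) (interchange (f 0) (g 0) _ _)

pairSum-cong : ∀ n {X Y : ℕ → ℕ → ℕ} → (∀ i j → i < j → j < n → X i j ≡ Y i j) →
               pairSum n X ≡ pairSum n Y
pairSum-cong zero    eq = refl
pairSum-cong (suc n) eq =
  cong₂ _+_ (pairSum-cong n (λ i j i<j j<n → eq i j i<j (m<n⇒m<1+n j<n)))
            (sum<-cong n (λ i i<n → eq i n i<n (n<1+n n)))

pairSum-zero : ∀ n (X : ℕ → ℕ → ℕ) → (∀ i j → i < j → j < n → X i j ≡ 0) → pairSum n X ≡ 0
pairSum-zero zero    X vanish = refl
pairSum-zero (suc n) X vanish =
  cong₂ _+_ (pairSum-zero n X (λ i j i<j j<n → vanish i j i<j (m<n⇒m<1+n j<n)))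
            (sum<-zero n _ (λ i i<n → vanish i n i<n (n<1+n n)))

pairSum-+ : ∀ n (X Y : ℕ → ℕ → ℕ) → pairSum n (λ i j → X i j + Y i j) ≡ pairSum n X + pairSum n Y
pairSum-+ zero    X Y = refl
pairSum-+ (suc n) X Y =
  trans (cong₂ _+_ (pairSum-+ n X Y) (sum<-+ n _ _)) (interchange (pairSum n X) (pairSum n Y) _ _)

squareSum-upper : ∀ n (F : ℕ → ℕ → ℕ) → (∀ i j → j ≤ i → i < n → F i j ≡ 0) →
                  sum< n (λ i → sum< n (F i)) ≡ pairSum n F
squareSum-upper zero    F vanish = refl
squareSum-upper (suc n) F vanish = begin
  sum< (suc n) (λ i → sum< (suc n) (F i))
    ≡⟨ sum<-snoc n _ ⟩
  sum< n (λ i → sum< (suc n) (F i)) + sum< (suc n) (F n)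
    ≡⟨ cong₂ _+_ (sum<-cong n (λ i _ → sum<-snoc n (F i)))
                 (sum<-zero (suc n) _ (λ j j≤n → vanish n j (≤-pred j≤n) (n<1+n n))) ⟩
  sum< n (λ i → sum< n (F i) + F i n) + 0
    ≡⟨ trans (+-identityʳ _) (sum<-+ n _ _) ⟩
  sum< n (λ i → sum< n (F i)) + sum< n (λ i → F i n)
    ≡⟨ cong (_+ sum< n (λ i → F i n))
            (squareSum-upper n F (λ i j j≤i i<n → vanish i j j≤i (m<n⇒m<1+n i<n))) ⟩
  pairSum n F + sum< n (λ i → F i n) ∎
  where open ≡-Reasoning

squareSum-lower : ∀ n (F : ℕ → ℕ → ℕ) → (∀ i j → i ≤ j → j < n → F i j ≡ 0) →
                  sum< n (λ i → sum< n (F i)) ≡ pairSum n (λ i j → F j i)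
squareSum-lower zero    F vanish = refl
squareSum-lower (suc n) F vanish = begin
  sum< (suc n) (λ i → sum< (suc n) (F i))
    ≡⟨ sum<-snoc n _ ⟩
  sum< n (λ i → sum< (suc n) (F i)) + sum< (suc n) (F n)
    ≡⟨ cong₂ _+_ (trans (sum<-cong n (λ i _ → sum<-snoc n (F i))) (sum<-+ n _ _)) (sum<-snoc n (F n)) ⟩
  (sum< n (λ i → sum< n (F i)) + sum< n (λ i → F i n)) + (sum< n (F n) + F n n)
    ≡⟨ cong₂ _+_ (cong₂ _+_ (squareSum-lower n F (λ i j i≤j j<n → vanish i j i≤j (m<n⇒m<1+n j<n)))
                            (sum<-zero n _ (λ i i<n → vanish i n (<⇒≤ i<n) (n<1+n n))))
                 (cong (_+_ (sum< n (F n))) (vanish n n ≤-refl (n<1+n n))) ⟩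
  (pairSum n (λ i j → F j i) + 0) + (sum< n (F n) + 0)
    ≡⟨ cong₂ _+_ (+-identityʳ (pairSum n (λ i j → F j i))) (+-identityʳ (sum< n (F n))) ⟩
  pairSum n (λ i j → F j i) + sum< n (F n) ∎
  where open ≡-Reasoning

sum-allFin : ∀ n (h : Fin n → ℕ) (g : ℕ → ℕ) → (∀ i → h i ≡ g (toℕ i)) →
             sum (map h (allFin n)) ≡ sum< n g
sum-allFin n h g eq = trans (cong sum (map-tabulate (λ i → i) h)) (sum-tabulate n h g eq)
  where
    sum-tabulate : ∀ n (h : Fin n → ℕ) (g : ℕ → ℕ) → (∀ i → h i ≡ g (toℕ i)) →
                   sum (Data.List.tabulate h) ≡ sum< n g
    sum-tabulate zero    h g eq = refl
    sum-tabulate (suc n) h g eq =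
      cong₂ _+_ (eq fzero) (sum-tabulate n (λ i → h (fsuc i)) (λ k → g (suc k)) (λ i → eq (fsuc i)))

tri : ℕ → ℕ
tri zero    = 0
tri (suc n) = tri n + n

sum<-id : ∀ n → sum< n (λ k → k) ≡ tri n
sum<-id zero    = refl
sum<-id (suc n) = trans (sum<-snoc n (λ k → k)) (cong (_+ n) (sum<-id n))

<ᵇ-true : ∀ {m n} → m < n → (m <ᵇ n) ≡ true
<ᵇ-true m<n = Equivalence.to T-≡ (<⇒<ᵇ m<n)

<ᵇ-false : ∀ {m n} → n ≤ m → (m <ᵇ n) ≡ false
<ᵇ-false {m}     {zero}  _         = refl
<ᵇ-false {suc m} {suc n} (s≤s n≤m) = <ᵇ-false n≤m

≡ᵇ-refl : ∀ m → (m ≡ᵇ m) ≡ true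
≡ᵇ-refl m = Equivalence.to T-≡ (≡⇒≡ᵇ m m refl)

≡ᵇ-false : ∀ {m n} → m ≢ n → (m ≡ᵇ n) ≡ false
≡ᵇ-false {zero}  {zero}  m≢n = ⊥-elim (m≢n refl)
≡ᵇ-false {zero}  {suc n} m≢n = refl
≡ᵇ-false {suc m} {zero}  m≢n = refl
≡ᵇ-false {suc m} {suc n} m≢n = ≡ᵇ-false (m≢n ∘ cong suc)

<ᵇ-sound : ∀ {m n} → (m <ᵇ n) ≡ true → m < n
<ᵇ-sound {m} {n} eq = <ᵇ⇒< m n (Equivalence.from T-≡ eq)

≡ᵇ-sound : ∀ m n → (m ≡ᵇ n) ≡ true → m ≡ n
≡ᵇ-sound m n eq = ≡ᵇ⇒≡ m n (Equivalence.from T-≡ eq)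

ind-∧false : ∀ b → ind (b ∧ false) ≡ 0
ind-∧false true  = refl
ind-∧false false = refl

-- The path of a blueprint is a sequence of East runs, each followed by a
-- North step; these lemmas read its counts, columns and valleys off the runs.

east : ℕ → List Step
east e = replicate e E

-- 'Above h s': read from a point h units above the diagonal, s never dips
-- below the diagonal.
data Above : ℕ → List Step → Set where
  done   : ∀ {h} → Above h []
  northA : ∀ {h s} → Above (suc h) s → Above h (N ∷ s)
  eastA  : ∀ {h s} → Above h s → Above (suc h) (E ∷ s)

above-prefix : ∀ {h s} → Above h s → ∀ k → countE (take k s) ≤ h + countN (take k s)
above-prefix done       zero    = z≤n
above-prefix done       (suc k) = z≤n
above-prefix (northA a) zero    = z≤n
above-prefix {h} (northA {s = s} a) (suc k) =
  subst (countE (take k s) ≤_) (sym (+-suc h _)) (above-prefix a k)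
above-prefix (eastA a)  zero    = z≤n
above-prefix (eastA a)  (suc k) = s≤s (above-prefix a k)

above-east : ∀ e {h s} → Above h s → Above (e + h) (east e ++ s)
above-east zero    a = a
above-east (suc e) a = eastA (above-east e a)

countN-east : ∀ e s → countN (east e ++ s) ≡ countN s
countN-east zero    s = refl
countN-east (suc e) s = countN-east e s

countE-east : ∀ e s → countE (east e ++ s) ≡ e + countE s
countE-east zero    s = refl
countE-east (suc e) s = cong suc (countE-east e s)

northCols-east : ∀ e x s → northCols' x (east e ++ s) ≡ northCols' (x + e) s
northCols-east zero    x s = cong (λ z → northCols' z s) (sym (+-identityʳ x))
northCols-east (suc e) x s = trans (northCols-east e (suc x) s) (cong (λ z → northCols' z s) (sym (+-suc x e)))

afterEast : Bool → ℕ → Bool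
afterEast b zero    = b
afterEast b (suc _) = true

northPrevE-east : ∀ e b s → northPrevE' b (east e ++ N ∷ s) ≡ afterEast b e ∷ northPrevE' false s
northPrevE-east zero          b s = refl
northPrevE-east (suc zero)    b s = refl
northPrevE-east (suc (suc e)) b s = northPrevE-east (suc e) true s

afterEast-gap : ∀ a b → a < b → afterEast false (b ∸ a) ≡ true
afterEast-gap zero    (suc b) _         = refl
afterEast-gap (suc a) (suc b) (s≤s a<b) = afterEast-gap a b a<b

-- A valley-marked parking function is determined by its rows: row k (the
-- k-th North step) lies in some diagonal, carries a car and may be marked.

record Blueprint (n : ℕ) : Set where
  field
    diagOf : ℕ → ℕ
    carOf  : ℕ → ℕ
    markOf : ℕ → Bool
    -- a Dyck path: it starts on the main diagonal and climbs at most one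
    -- diagonal per row
    diag-start : diagOf 0 ≡ 0
    diag-step  : ∀ k → suc k < n → diagOf (suc k) ≤ suc (diagOf k)
    car-pos    : ∀ k → k < n → 0 < carOf k
    car-inj    : ∀ i j → i < n → j < n → carOf i ≡ carOf j → i ≡ j
    car-column : ∀ k → suc k < n → diagOf (suc k) ≡ suc (diagOf k) → carOf k < carOf (suc k)
    -- only valleys are marked: never row 0, and row k+1 only if its North
    -- step follows an East step (its diagonal does not rise) and car k, when
    -- it sits in the cell below that East step, is the smaller one
    start-unmarked : markOf 0 ≡ false
    mark-valley : ∀ k → suc k < n → markOf (suc k) ≡ true →
                  diagOf (suc k) ≤ diagOf k × (diagOf (suc k) ≡ diagOf k → carOf k < carOf (suc k))

  primaryAt secondaryAt : ℕ → ℕ → Bool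
  primaryAt   a b = (carOf a <ᵇ carOf b) ∧ ((diagOf a ≡ᵇ diagOf b) ∧ not (markOf a))
  secondaryAt a b = (carOf b <ᵇ carOf a) ∧ ((diagOf a ≡ᵇ suc (diagOf b)) ∧ not (markOf a))

  inversionsAt : ℕ → ℕ → ℕ
  inversionsAt a b = ind (primaryAt a b) + ind (secondaryAt a b)

-- The MPF of a blueprint: the North step of row k lies in column
-- k - diagOf k, and the path walks from each North step to the next.
module Realize {n : ℕ} (bp : Blueprint n) where
  open Blueprint bp
  open ≡-Reasoning

  diag≤row : ∀ k → k < n → diagOf k ≤ k
  diag≤row zero    _     = ≤-reflexive diag-start
  diag≤row (suc k) sk<n = ≤-trans (diag-step k sk<n) (s≤s (diag≤row k (<-trans (n<1+n k) sk<n)))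

  column : ℕ → ℕ
  column k = k ∸ diagOf k

  column≤row : ∀ k → column k ≤ k
  column≤row k = m∸n≤m k (diagOf k)

  column-mono : ∀ k → suc k < n → column k ≤ column (suc k)
  column-mono k sk<n = ∸-monoʳ-≤ (suc k) (diag-step k sk<n)

  -- the path from the point (x, k), with r rows still to place
  walk : ℕ → ℕ → ℕ → List Step
  walk k x zero    = east (k ∸ x)
  walk k x (suc r) = east (column k ∸ x) ++ N ∷ walk (suc k) (column k) r

  thePath : List Step
  thePath = walk 0 0 n

  record OnTrack (k x r : ℕ) : Set where
    field
      x≤k     : x ≤ k
      x≤col   : 0 < r → x ≤ column k
      in-range : k + r ≤ n

  ontrack-start : OnTrack 0 0 n
  ontrack-start = record { x≤k = z≤n ; x≤col = λ _ → z≤n ; in-range = ≤-refl }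

  next-in-range : ∀ {k} r → 0 < r → k + suc r ≤ n → suc k < n
  next-in-range {k} (suc r) _ k+r≤n =
    ≤-trans (m≤m+n (suc (suc k)) r) (≤-trans (≤-reflexive (sym (trans (+-suc k (suc r)) (cong suc (+-suc k r))))) k+r≤n)

  ontrack-step : ∀ {k x r} → OnTrack k x (suc r) → OnTrack (suc k) (column k) r
  ontrack-step {k} {x} {r} tr = record
    { x≤k     = ≤-trans (column≤row k) (n≤1+n k)
    ; x≤col   = λ 0<r → column-mono k (next-in-range r 0<r (OnTrack.in-range tr))
    ; in-range = subst (_≤ n) (+-suc k r) (OnTrack.in-range tr) }

  columns : ℕ → ℕ → List ℕ
  columns k zero    = []
  columns k (suc r) = column k ∷ columns (suc k) r

  walk-columns : ∀ k x r → OnTrack k x r → northCols' x (walk k x r) ≡ columns k r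
  walk-columns k x zero    tr =
    trans (cong (northCols' x) (sym (++-identityʳ (east (k ∸ x))))) (northCols-east (k ∸ x) x [])
  walk-columns k x (suc r) tr = begin
    northCols' x (east (column k ∸ x) ++ N ∷ walk (suc k) (column k) r)
      ≡⟨ northCols-east (column k ∸ x) x _ ⟩
    northCols' (x + (column k ∸ x)) (N ∷ walk (suc k) (column k) r)
      ≡⟨ cong (λ z → northCols' z (N ∷ walk (suc k) (column k) r))
              (m+[n∸m]≡n (OnTrack.x≤col tr (s≤s z≤n))) ⟩
    column k ∷ northCols' (column k) (walk (suc k) (column k) r)
      ≡⟨ cong (column k ∷_) (walk-columns (suc k) (column k) r (ontrack-step tr)) ⟩
    column k ∷ columns (suc k) r ∎

  -- row k+1 follows an East step iff its column exceeds that of row k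
  eastFlags : ℕ → ℕ → ℕ → List Bool
  eastFlags k x zero    = []
  eastFlags k x (suc r) = afterEast false (column k ∸ x) ∷ eastFlags (suc k) (column k) r

  walk-eastFlags : ∀ k x r → northPrevE' false (walk k x r) ≡ eastFlags k x r
  walk-eastFlags k x zero    = no-flags (k ∸ x) false
    where
      no-flags : ∀ e b → northPrevE' b (east e) ≡ []
      no-flags zero    b = refl
      no-flags (suc e) b = no-flags e true
  walk-eastFlags k x (suc r) =
    trans (northPrevE-east (column k ∸ x) false _)
          (cong (afterEast false (column k ∸ x) ∷_) (walk-eastFlags (suc k) (column k) r))

  walk-countN : ∀ k x r → countN (walk k x r) ≡ r
  walk-countN k x zero    = trans (cong countN (sym (++-identityʳ (east (k ∸ x))))) (countN-east (k ∸ x) [])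
  walk-countN k x (suc r) = trans (countN-east (column k ∸ x) _) (cong suc (walk-countN (suc k) (column k) r))

  walk-countE : ∀ k x r → OnTrack k x r → countE (walk k x r) + x ≡ k + r
  walk-countE k x zero tr = begin
    countE (east (k ∸ x)) + x ≡⟨ cong (λ s → countE s + x) (sym (++-identityʳ (east (k ∸ x)))) ⟩
    countE (east (k ∸ x) ++ []) + x ≡⟨ cong (_+ x) (trans (countE-east (k ∸ x) []) (+-identityʳ _)) ⟩
    (k ∸ x) + x ≡⟨ m∸n+n≡m (OnTrack.x≤k tr) ⟩
    k ≡⟨ +-identityʳ k ⟨
    k + 0 ∎
  walk-countE k x (suc r) tr = begin
    countE (east (column k ∸ x) ++ N ∷ rest) + x ≡⟨ cong (_+ x) (countE-east (column k ∸ x) _) ⟩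
    (column k ∸ x) + countE rest + x             ≡⟨ cong (_+ x) (+-comm (column k ∸ x) _) ⟩
    countE rest + (column k ∸ x) + x             ≡⟨ +-assoc (countE rest) _ x ⟩
    countE rest + ((column k ∸ x) + x)           ≡⟨ cong (_+_ (countE rest)) (m∸n+n≡m (OnTrack.x≤col tr (s≤s z≤n))) ⟩
    countE rest + column k                       ≡⟨ walk-countE (suc k) (column k) r (ontrack-step tr) ⟩
    suc k + r                                    ≡⟨ +-suc k r ⟨
    k + suc r ∎
    where rest = walk (suc k) (column k) r

  walk-above : ∀ k x r → OnTrack k x r → Above (k ∸ x) (walk k x r)
  walk-above k x zero    tr = subst (Above (k ∸ x)) (++-identityʳ (east (k ∸ x)))
                                    (subst (λ h → Above h (east (k ∸ x) ++ [])) (+-identityʳ (k ∸ x))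
                                           (above-east (k ∸ x) done))
  walk-above k x (suc r) tr =
    subst (λ h → Above h (walk k x (suc r))) (sym split)
          (above-east (column k ∸ x)
            (northA (subst (λ h → Above h (walk (suc k) (column k) r)) lift
                           (walk-above (suc k) (column k) r (ontrack-step tr)))))
    where
      x≤col = OnTrack.x≤col tr (s≤s z≤n)
      split : k ∸ x ≡ (column k ∸ x) + (k ∸ column k)
      split = begin
        k ∸ x                                ≡⟨ cong (_∸ x) (sym (m∸n+n≡m (column≤row k))) ⟩
        ((k ∸ column k) + column k) ∸ x      ≡⟨ +-∸-assoc (k ∸ column k) x≤col ⟩
        (k ∸ column k) + (column k ∸ x)      ≡⟨ +-comm (k ∸ column k) _ ⟩
        (column k ∸ x) + (k ∸ column k)      ∎
      lift : suc k ∸ column k ≡ suc (k ∸ column k)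
      lift = +-∸-assoc 1 (column≤row k)

  theDyck : IsDyck n thePath
  theDyck = record
    { northCount = walk-countN 0 0 n
    ; eastCount  = trans (sym (+-identityʳ _)) (walk-countE 0 0 n ontrack-start)
    ; above      = above-prefix (walk-above 0 0 n ontrack-start) }

  nth-columns : ∀ k r i → i < r → nth (columns k r) i ≡ column (i + k)
  nth-columns k (suc r) zero    _         = refl
  nth-columns k (suc r) (suc i) (s≤s i<r) = trans (nth-columns (suc k) r i i<r) (cong column (+-suc i k))

  path-column : ∀ a → a < n → nth (northCols thePath) a ≡ column a
  path-column a a<n = begin
    nth (northCols' 0 (walk 0 0 n)) a ≡⟨ cong (λ l → nth l a) (walk-columns 0 0 n ontrack-start) ⟩
    nth (columns 0 n) a               ≡⟨ nth-columns 0 n a a<n ⟩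
    column (a + 0)                    ≡⟨ cong column (+-identityʳ a) ⟩
    column a                          ∎

  nthB-eastFlags : ∀ k x r i → suc i < r →
    nthB (eastFlags k x r) (suc i) ≡ afterEast false (column (suc (i + k)) ∸ column (i + k))
  nthB-eastFlags k x (suc (suc r)) zero    _           = refl
  nthB-eastFlags k x (suc r)       (suc i) (s≤s si<r) =
    trans (nthB-eastFlags (suc k) (column k) r i si<r)
          (cong (λ z → afterEast false (column (suc z) ∸ column z)) (+-suc i k))

  path-eastFlag : ∀ a → suc a < n →
    nthB (northPrevE thePath) (suc a) ≡ afterEast false (column (suc a) ∸ column a)
  path-eastFlag a sa<n = begin
    nthB (northPrevE' false (walk 0 0 n)) (suc a)
      ≡⟨ cong (λ l → nthB l (suc a)) (walk-eastFlags 0 0 n) ⟩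
    nthB (eastFlags 0 0 n) (suc a)
      ≡⟨ nthB-eastFlags 0 0 n a sa<n ⟩
    afterEast false (column (suc (a + 0)) ∸ column (a + 0))
      ≡⟨ cong (λ z → afterEast false (column (suc z) ∸ column z)) (+-identityʳ a) ⟩
    afterEast false (column (suc a) ∸ column a) ∎

  diag-from-column : ∀ a → a < n → a ∸ column a ≡ diagOf a
  diag-from-column a a<n = m∸[m∸n]≡n (diag≤row a a<n)

  area-columns : ∀ k r → areaFrom k (columns k r) ≡ sum< r (λ j → (j + k) ∸ column (j + k))
  area-columns k zero    = refl
  area-columns k (suc r) = cong (_+_ (k ∸ column k))
    (trans (area-columns (suc k) r) (sum<-cong r (λ j _ → cong (λ z → z ∸ column z) (+-suc j k))))

  same-column-rise : ∀ a → suc a < n → column (suc a) ≡ column a → diagOf (suc a) ≡ suc (diagOf a)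
  same-column-rise a sa<n eq = +-cancelˡ-≡ (column a) _ _ (begin
    column a + diagOf (suc a)         ≡⟨ cong (_+ diagOf (suc a)) eq ⟨
    column (suc a) + diagOf (suc a)   ≡⟨ m∸n+n≡m (diag≤row (suc a) sa<n) ⟩
    suc a                             ≡⟨ cong suc (m∸n+n≡m (diag≤row a (<-trans (n<1+n a) sa<n))) ⟨
    suc (column a + diagOf a)         ≡⟨ +-suc (column a) (diagOf a) ⟨
    column a + suc (diagOf a)         ∎)

  adjacent-column-flat : ∀ a → suc a < n → diagOf (suc a) ≤ diagOf a →
                         column a ≡ pred (column (suc a)) → diagOf a ≡ diagOf (suc a)
  adjacent-column-flat a sa<n le eq =
    ∸-cancelˡ-≡ da≤a (≤-trans le da≤a) (trans eq (cong pred (+-∸-assoc 1 (≤-trans le da≤a))))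
    where da≤a = diag≤row a (<-trans (n<1+n a) sa<n)

  flat-column-< : ∀ a b → a < b → b < n → diagOf a ≡ diagOf b → column a < column b
  flat-column-< a b a<b b<n eq =
    subst (λ d → a ∸ diagOf a < b ∸ d) eq (∸-monoˡ-< a<b (diag≤row a (<-trans a<b b<n)))

  flat-column-≤ : ∀ a b → b ≤ a → diagOf a ≡ diagOf b → column b ≤ column a
  flat-column-≤ a b b≤a eq = subst (λ d → b ∸ d ≤ a ∸ diagOf a) eq (∸-monoˡ-≤ (diagOf a) b≤a)

  raised-column-< : ∀ a b → a < b → b < n → diagOf a ≡ suc (diagOf b) → column a < column b
  raised-column-< a b a<b b<n eq = ≤-trans (≤-reflexive shift) (∸-monoˡ-≤ (diagOf b) (<⇒≤ a<b))
    where
      db<a : suc (diagOf b) ≤ a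
      db<a = subst (_≤ a) eq (diag≤row a (<-trans a<b b<n))
      shift : suc (a ∸ diagOf a) ≡ a ∸ diagOf b
      shift = trans (cong (λ d → suc (a ∸ d)) eq) (sym (+-∸-assoc 1 db<a))

  raised-column-≤ : ∀ a b → a ≤ b → diagOf b ≡ suc (diagOf a) → column a ≤ column b
  raised-column-≤ a b a≤b eq with m≤n⇒m<n∨m≡n a≤b
  ... | inj₂ refl = ⊥-elim (1+n≢n (sym eq))
  ... | inj₁ a<b = subst (λ d → a ∸ diagOf a ≤ b ∸ d) (sym eq) (∸-monoˡ-≤ (suc (diagOf a)) a<b)

  carF : Fin n → ℕ
  carF i = carOf (toℕ i)

  markSet : Subset n
  markSet = tabulate (λ i → markOf (toℕ i))

  pathCol : Fin n → ℕ
  pathCol i = nth (northCols thePath) (toℕ i)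

  column-increasing : ∀ (i j : Fin n) → toℕ j ≡ suc (toℕ i) → pathCol j ≡ pathCol i → carF i < carF j
  column-increasing i j j≡1+i eq =
    subst (λ b → carF i < carOf b) (sym j≡1+i) (car-column (toℕ i) si<n (same-column-rise (toℕ i) si<n same))
    where
      si<n : suc (toℕ i) < n
      si<n = subst (_< n) j≡1+i (toℕ<n j)
      same : column (suc (toℕ i)) ≡ column (toℕ i)
      same = begin
        column (suc (toℕ i)) ≡⟨ cong column j≡1+i ⟨
        column (toℕ j)       ≡⟨ path-column (toℕ j) (toℕ<n j) ⟨
        pathCol j            ≡⟨ eq ⟩
        pathCol i            ≡⟨ path-column (toℕ i) (toℕ<n i) ⟩
        column (toℕ i)       ∎

  valley : ∀ a → a < n → markOf a ≡ true →
    nthB (northPrevE thePath) a ≡ true ×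
    (∀ b → b ≡ pred a → column b ≡ pred (column a) → carOf b < carOf a)
  valley zero    _    marked = ⊥-elim (false≢true (trans (sym start-unmarked) marked))
    where
      false≢true : false ≢ true
      false≢true ()
  valley (suc a) sa<n marked = afterEastStep , belowSmaller
    where
      flat = mark-valley a sa<n marked
      da≤a = diag≤row a (<-trans (n<1+n a) sa<n)
      steps-right : column a < column (suc a)
      steps-right = ≤-trans (≤-reflexive (sym (+-∸-assoc 1 da≤a))) (∸-monoʳ-≤ (suc a) (proj₁ flat))
      afterEastStep = trans (path-eastFlag a sa<n) (afterEast-gap (column a) (column (suc a)) steps-right)
      belowSmaller : ∀ b → b ≡ a → column b ≡ pred (column (suc a)) → carOf b < carOf (suc a)
      belowSmaller .a refl eq = proj₂ flat (sym (adjacent-column-flat a sa<n (proj₁ flat) eq))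

  marked-valley : ∀ (k : Fin n) → lookup markSet k ≡ true →
    nthB (northPrevE thePath) (toℕ k) ≡ true ×
    (∀ (i : Fin n) → toℕ i ≡ pred (toℕ k) → pathCol i ≡ pred (pathCol k) → carF i < carF k)
  marked-valley k marked with valley (toℕ k) (toℕ<n k) (trans (sym (lookup∘tabulate _ k)) marked)
  ... | afterEastStep , belowSmaller = afterEastStep , λ i i≡k-1 eq →
    belowSmaller (toℕ i) i≡k-1
      (trans (sym (path-column _ (toℕ<n i))) (trans eq (cong pred (path-column _ (toℕ<n k)))))

  theMPF : MPF n
  theMPF = record
    { path = thePath ; dyck = theDyck ; car = carF
    ; carPos = λ k → car-pos (toℕ k) (toℕ<n k)
    ; carInj = λ {i} {j} eq → toℕ-injective (car-inj _ _ (toℕ<n i) (toℕ<n j) eq)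
    ; marked = markSet
    ; colIncr = column-increasing
    ; markedValley = marked-valley }

  area-theMPF : area theMPF ≡ sum< n diagOf
  area-theMPF = begin
    areaFrom 0 (northCols' 0 (walk 0 0 n)) ≡⟨ cong (areaFrom 0) (walk-columns 0 0 n ontrack-start) ⟩
    areaFrom 0 (columns 0 n)               ≡⟨ area-columns 0 n ⟩
    sum< n (λ j → (j + 0) ∸ column (j + 0))
      ≡⟨ sum<-cong n (λ j j<n → trans (cong (λ z → z ∸ column z) (+-identityʳ j)) (diag-from-column j j<n)) ⟩
    sum< n diagOf ∎

  marks-theMPF : numMarked theMPF ≡ sum< n (λ k → ind (markOf k))
  marks-theMPF = sum-allFin n _ _ (λ i → cong ind (lookup∘tabulate (λ i → markOf (toℕ i)) i))

  primaryRows secondaryRows : ℕ → ℕ → Bool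
  primaryRows a b =
    (carOf a <ᵇ carOf b) ∧ ((diagOf a ≡ᵇ diagOf b) ∧ ((column a <ᵇ column b) ∧ not (markOf a)))
  secondaryRows a b =
    (carOf a <ᵇ carOf b) ∧ ((diagOf b ≡ᵇ suc (diagOf a)) ∧ ((column b <ᵇ column a) ∧ not (markOf b)))

  primary-rows : ∀ (i j : Fin n) →
    (carF i <ᵇ carF j) ∧ ((diag theMPF i ≡ᵇ diag theMPF j) ∧ ((pathCol i <ᵇ pathCol j) ∧ not (lookup markSet i)))
      ≡ primaryRows (toℕ i) (toℕ j)
  primary-rows i j
    rewrite path-column (toℕ i) (toℕ<n i) | path-column (toℕ j) (toℕ<n j)
          | diag-from-column (toℕ i) (toℕ<n i) | diag-from-column (toℕ j) (toℕ<n j)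
          | lookup∘tabulate (λ i → markOf (toℕ i)) i = refl

  secondary-rows : ∀ (i j : Fin n) →
    (carF i <ᵇ carF j) ∧ ((diag theMPF j ≡ᵇ suc (diag theMPF i)) ∧ ((pathCol j <ᵇ pathCol i) ∧ not (lookup markSet j)))
      ≡ secondaryRows (toℕ i) (toℕ j)
  secondary-rows i j
    rewrite path-column (toℕ i) (toℕ<n i) | path-column (toℕ j) (toℕ<n j)
          | diag-from-column (toℕ i) (toℕ<n i) | diag-from-column (toℕ j) (toℕ<n j)
          | lookup∘tabulate (λ i → markOf (toℕ i)) j = refl

  -- a primary inversion needs the lower row to be the left one ...
  primaryRows-lower : ∀ a b → b ≤ a → ind (primaryRows a b) ≡ 0
  primaryRows-lower a b b≤a with diagOf a ≡ᵇ diagOf b in eq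
  ... | true  rewrite <ᵇ-false (flat-column-≤ a b b≤a (≡ᵇ-sound _ _ eq)) = ind-∧false (carOf a <ᵇ carOf b)
  ... | false = ind-∧false (carOf a <ᵇ carOf b)

  primaryRows-upper : ∀ a b → a < b → b < n → ind (primaryRows a b) ≡ ind (primaryAt a b)
  primaryRows-upper a b a<b b<n with diagOf a ≡ᵇ diagOf b in eq
  ... | true  rewrite <ᵇ-true (flat-column-< a b a<b b<n (≡ᵇ-sound _ _ eq)) = refl
  ... | false = refl

  -- ... and a secondary one needs the raised row to be the lower one
  secondaryRows-lower : ∀ a b → a ≤ b → ind (secondaryRows a b) ≡ 0
  secondaryRows-lower a b a≤b with diagOf b ≡ᵇ suc (diagOf a) in eq
  ... | true  rewrite <ᵇ-false (raised-column-≤ a b a≤b (≡ᵇ-sound _ _ eq)) = ind-∧false (carOf a <ᵇ carOf b)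
  ... | false = ind-∧false (carOf a <ᵇ carOf b)

  secondaryRows-upper : ∀ a b → a < b → b < n → ind (secondaryRows b a) ≡ ind (secondaryAt a b)
  secondaryRows-upper a b a<b b<n with diagOf a ≡ᵇ suc (diagOf b) in eq
  ... | true  rewrite <ᵇ-true (raised-column-< a b a<b b<n (≡ᵇ-sound _ _ eq)) = refl
  ... | false = refl

  primary-theMPF : primary theMPF ≡ pairSum n (λ a b → ind (primaryAt a b))
  primary-theMPF = begin
    primary theMPF
      ≡⟨ sum-allFin n _ _ (λ i → sum-allFin n _ _ (λ j → cong ind (primary-rows i j))) ⟩
    sum< n (λ a → sum< n (λ b → ind (primaryRows a b)))
      ≡⟨ squareSum-upper n _ (λ a b b≤a _ → primaryRows-lower a b b≤a) ⟩
    pairSum n (λ a b → ind (primaryRows a b))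
      ≡⟨ pairSum-cong n primaryRows-upper ⟩
    pairSum n (λ a b → ind (primaryAt a b)) ∎

  secondary-theMPF : secondary theMPF ≡ pairSum n (λ a b → ind (secondaryAt a b))
  secondary-theMPF = begin
    secondary theMPF
      ≡⟨ sum-allFin n _ _ (λ i → sum-allFin n _ _ (λ j → cong ind (secondary-rows i j))) ⟩
    sum< n (λ a → sum< n (λ b → ind (secondaryRows a b)))
      ≡⟨ squareSum-lower n _ (λ a b a≤b _ → secondaryRows-lower a b a≤b) ⟩
    pairSum n (λ a b → ind (secondaryRows b a))
      ≡⟨ pairSum-cong n secondaryRows-upper ⟩
    pairSum n (λ a b → ind (secondaryAt a b)) ∎

realize : ∀ {n} (bp : Blueprint n) → let open Blueprint bp in
  Σ (MPF n) λ M → area M ≡ sum< n diagOf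
                × primary M + secondary M ≡ pairSum n inversionsAt
                × numMarked M ≡ sum< n (λ k → ind (markOf k))
realize {n} bp = theMPF , area-theMPF
  , trans (cong₂ _+_ primary-theMPF secondary-theMPF) (sym (pairSum-+ n _ _))
  , marks-theMPF
  where open Realize bp
        open Blueprint bp

-- Every MPF we build starts with a staircase of p rows in diagonals
-- 0, …, p - 1 and continues with a tower of rows in diagonal p (lane low)
-- or p + 1 (lane high).  A tower row is rising (its car grows with its
-- height), falling (its car shrinks with its height) or a mark (rising, and
-- a marked valley).

data Lane : Set where
  low high : Lane

data Role : Set where
  rise fall mark : Role

Row : Set
Row = Lane × Role

data Kind : Set where
  stair : Kind
  tower : Row → Kind

isMark : Role → Bool
isMark mark = true
isMark _    = false

-- Cars come in bands of width n (the size): band b holds b·n + 1, …, b·n + n.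
-- Falling low rows use band 0, the staircase and rising low rows band 1,
-- falling high rows band 2 and rising high rows band 3; odd bands are
-- filled upwards, even bands downwards.
laneBase : Lane → ℕ
laneBase low  = 0
laneBase high = 2

roleBand : Role → ℕ
roleBand fall = 0
roleBand _    = 1

band : Kind → ℕ
band stair          = 1
band (tower (ℓ , ρ)) = laneBase ℓ + roleBand ρ

climbs : ℕ → Bool
climbs 0 = false
climbs 1 = true
climbs 2 = false
climbs _ = true

offset : ℕ → ℕ → ℕ → ℕ
offset n b k = if climbs b then suc k else n ∸ k

carIn : ℕ → ℕ → ℕ → ℕ
carIn n b k = b * n + offset n b k

carOfKind : ℕ → Kind → ℕ → ℕ
carOfKind n κ k = carIn n (band κ) k

offset-pos : ∀ n b k → k < n → 0 < offset n b k
offset-pos n b k k<n with climbs b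
... | true  = s≤s z≤n
... | false = m<n⇒0<n∸m k<n

offset-≤ : ∀ n b k → k < n → offset n b k ≤ n
offset-≤ n b k k<n with climbs b
... | true  = k<n
... | false = m∸n≤m n k

carIn-pos : ∀ n b k → k < n → 0 < carIn n b k
carIn-pos n b k k<n = ≤-trans (offset-pos n b k k<n) (m≤n+m _ (b * n))

carIn-band-< : ∀ n b b' x y → b < b' → x < n → y < n → carIn n b x < carIn n b' y
carIn-band-< n b b' x y b<b' x<n y<n = ≤-<-trans (≤-trans below-next-band next-band≤) inside-band
  where
    below-next-band : b * n + offset n b x ≤ suc b * n
    below-next-band = ≤-trans (+-monoʳ-≤ (b * n) (offset-≤ n b x x<n)) (≤-reflexive (+-comm (b * n) n))
    next-band≤ : suc b * n ≤ b' * n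
    next-band≤ = *-monoˡ-≤ n b<b'
    inside-band : b' * n < b' * n + offset n b' y
    inside-band = m<m+n (b' * n) (offset-pos n b' y y<n)

carIn-climbing : ∀ n b x y → climbs b ≡ true → x < y → carIn n b x < carIn n b y
carIn-climbing n b x y up x<y rewrite up = +-monoʳ-< (b * n) (s≤s x<y)

carIn-falling : ∀ n b x y → climbs b ≡ false → x < y → y < n → carIn n b y < carIn n b x
carIn-falling n b x y down x<y y<n rewrite down = +-monoʳ-< (b * n) (∸-monoʳ-< x<y (<⇒≤ y<n))

carIn-injective : ∀ n b b' x y → x < n → y < n → carIn n b x ≡ carIn n b' y → x ≡ y
carIn-injective n b b' x y x<n y<n eq with <-cmp b b'
... | tri< b<b' _ _ = ⊥-elim (<-irrefl eq (carIn-band-< n b b' x y b<b' x<n y<n))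
... | tri> _ _ b'<b = ⊥-elim (<-irrefl (sym eq) (carIn-band-< n b' b y x b'<b y<n x<n))
... | tri≈ _ refl _ = offsets-injective (climbs b) (+-cancelˡ-≡ (b * n) _ _ eq)
  where
    offsets-injective : ∀ c → (if c then suc x else n ∸ x) ≡ (if c then suc y else n ∸ y) → x ≡ y
    offsets-injective true  eq' = suc-injective eq'
    offsets-injective false eq' = ∸-cancelˡ-≡ (<⇒≤ x<n) (<⇒≤ y<n) eq'

isRising : Role → Bool
isRising fall = false
isRising _    = true

climbs-rising : ∀ ℓ → climbs (laneBase ℓ + 1) ≡ true
climbs-rising low  = refl
climbs-rising high = refl

climbs-falling : ∀ ℓ → climbs (laneBase ℓ + 0) ≡ false
climbs-falling low  = refl
climbs-falling high = refl

fall<rise : ∀ ℓ → laneBase ℓ + 0 < laneBase ℓ + 1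
fall<rise ℓ = +-monoʳ-< (laneBase ℓ) (s≤s z≤n)

module SameLane (n : ℕ) (ℓ : Lane) {x y : ℕ} (x<y : x < y) (y<n : y < n) where
  x<n = <-trans x<y y<n

  rise-rise : (carIn n (laneBase ℓ + 1) x <ᵇ carIn n (laneBase ℓ + 1) y) ≡ true
  rise-rise = <ᵇ-true (carIn-climbing n (laneBase ℓ + 1) x y (climbs-rising ℓ) x<y)

  fall-rise : (carIn n (laneBase ℓ + 0) x <ᵇ carIn n (laneBase ℓ + 1) y) ≡ true
  fall-rise = <ᵇ-true (carIn-band-< n _ _ x y (fall<rise ℓ) x<n y<n)

  rise-fall : (carIn n (laneBase ℓ + 1) x <ᵇ carIn n (laneBase ℓ + 0) y) ≡ false
  rise-fall = <ᵇ-false (<⇒≤ (carIn-band-< n _ _ y x (fall<rise ℓ) y<n x<n))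

  fall-fall : (carIn n (laneBase ℓ + 0) x <ᵇ carIn n (laneBase ℓ + 0) y) ≡ false
  fall-fall = <ᵇ-false (<⇒≤ (carIn-falling n (laneBase ℓ + 0) x y (climbs-falling ℓ) x<y y<n))

same-lane-car : ∀ n ℓ ρ ρ' {x y} → x < y → y < n →
  (carOfKind n (tower (ℓ , ρ)) x <ᵇ carOfKind n (tower (ℓ , ρ')) y) ≡ isRising ρ'
same-lane-car n ℓ rise rise x<y y<n = SameLane.rise-rise n ℓ x<y y<n
same-lane-car n ℓ rise mark x<y y<n = SameLane.rise-rise n ℓ x<y y<n
same-lane-car n ℓ mark rise x<y y<n = SameLane.rise-rise n ℓ x<y y<n
same-lane-car n ℓ mark mark x<y y<n = SameLane.rise-rise n ℓ x<y y<n
same-lane-car n ℓ fall rise x<y y<n = SameLane.fall-rise n ℓ x<y y<n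
same-lane-car n ℓ fall mark x<y y<n = SameLane.fall-rise n ℓ x<y y<n
same-lane-car n ℓ rise fall x<y y<n = SameLane.rise-fall n ℓ x<y y<n
same-lane-car n ℓ mark fall x<y y<n = SameLane.rise-fall n ℓ x<y y<n
same-lane-car n ℓ fall fall x<y y<n = SameLane.fall-fall n ℓ x<y y<n

roleBand≤1 : ∀ ρ → roleBand ρ ≤ 1
roleBand≤1 rise = ≤-refl
roleBand≤1 fall = z≤n
roleBand≤1 mark = ≤-refl

low<high : ∀ n ρ ρ' {x y} → x < n → y < n →
           carOfKind n (tower (low , ρ)) x < carOfKind n (tower (high , ρ')) y
low<high n ρ ρ' x<n y<n = carIn-band-< n _ _ _ _ (s≤s (≤-trans (roleBand≤1 ρ) (m≤m+n 1 (roleBand ρ')))) x<n y<n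

laneDiag : ℕ → Lane → ℕ
laneDiag p low  = p
laneDiag p high = suc p

diagOfKind : ℕ → Kind → ℕ → ℕ
diagOfKind p stair           k = k
diagOfKind p (tower (ℓ , _)) _ = laneDiag p ℓ

markOfKind : Kind → Bool
markOfKind stair           = false
markOfKind (tower (_ , ρ)) = isMark ρ

inversionsKinds : ℕ → ℕ → Kind → Kind → ℕ → ℕ → ℕ
inversionsKinds p n κ κ' a b =
  ind ((carOfKind n κ a <ᵇ carOfKind n κ' b) ∧ ((diagOfKind p κ a ≡ᵇ diagOfKind p κ' b) ∧ not (markOfKind κ))) +
  ind ((carOfKind n κ' b <ᵇ carOfKind n κ a) ∧ ((diagOfKind p κ a ≡ᵇ suc (diagOfKind p κ' b)) ∧ not (markOfKind κ)))

-- A tower is listed from the top down.  Its profile counts rows, high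
-- rows, marks, free (unmarked) rows, free high rows and the inversions
-- among its rows.  Adding a row on top adds the inversions it forms with
-- the free rows below it: a rising row (or mark) in lane ℓ pairs with the
-- free rows in lanes ≥ ℓ, a falling row with the free rows in lanes > ℓ.

record Profile : Set where
  constructor profile
  field
    size highs marks free freeHigh pairs : ℕ

open Profile

infixl 6 _⊕_
_⊕_ : Profile → Profile → Profile
P ⊕ Q = profile (size P + size Q) (highs P + highs Q) (marks P + marks Q)
                (free P + free Q) (freeHigh P + freeHigh Q) (pairs P + pairs Q)

freeFrom freeAbove : Lane → Profile → ℕ
freeFrom  low  = free
freeFrom  high = freeHigh
freeAbove low  = freeHigh
freeAbove high = λ _ → 0

gain : Row → Profile → ℕ
gain (ℓ , rise) = freeFrom ℓ
gain (ℓ , mark) = freeFrom ℓ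
gain (ℓ , fall) = freeAbove ℓ

onHigh : Lane → ℕ → ℕ
onHigh low  _ = 0
onHigh high k = k

freeInd : Role → ℕ
freeInd ρ = ind (not (isMark ρ))

-- the profile of a single row forming g inversions with the rows below
single : Row → ℕ → Profile
single (ℓ , ρ) g = profile 1 (onHigh ℓ 1) (ind (isMark ρ)) (freeInd ρ) (onHigh ℓ (freeInd ρ)) g

emptyProfile : Profile
emptyProfile = profile 0 0 0 0 0 0

profileOf : List Row → Profile
profileOf []      = emptyProfile
profileOf (r ∷ R) = profileOf R ⊕ single r (gain r (profileOf R))

gain-⊕ : ∀ r P Q → gain r (P ⊕ Q) ≡ gain r P + gain r Q
gain-⊕ (low  , rise) P Q = refl
gain-⊕ (low  , mark) P Q = refl
gain-⊕ (low  , fall) P Q = refl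
gain-⊕ (high , rise) P Q = refl
gain-⊕ (high , mark) P Q = refl
gain-⊕ (high , fall) P Q = refl

gain-empty : ∀ r → gain r emptyProfile ≡ 0
gain-empty (low  , rise) = refl
gain-empty (low  , mark) = refl
gain-empty (low  , fall) = refl
gain-empty (high , rise) = refl
gain-empty (high , mark) = refl
gain-empty (high , fall) = refl

credit : Kind → Row → ℕ
credit stair      r = 0
credit (tower r') r = gain r (single r' 0)

credit-same-lane : ∀ ℓ ρ ρ' → ind (isRising ρ' ∧ not (isMark ρ)) ≡ credit (tower (ℓ , ρ)) (ℓ , ρ')
credit-same-lane low  ρ rise = refl
credit-same-lane low  ρ mark = refl
credit-same-lane low  ρ fall = refl
credit-same-lane high ρ rise = refl
credit-same-lane high ρ mark = refl
credit-same-lane high ρ fall = refl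

credit-high-low : ∀ ρ ρ' → freeInd ρ ≡ credit (tower (high , ρ)) (low , ρ')
credit-high-low ρ rise = refl
credit-high-low ρ mark = refl
credit-high-low ρ fall = refl

credit-low-high : ∀ ρ ρ' → credit (tower (low , ρ)) (high , ρ') ≡ 0
credit-low-high ρ rise = refl
credit-low-high ρ mark = refl
credit-low-high ρ fall = refl

p≤laneDiag : ∀ p ℓ → p ≤ laneDiag p ℓ
p≤laneDiag p low  = ≤-refl
p≤laneDiag p high = n≤1+n p

inversions-credit : ∀ p n κ r {a b} → a < b → b < n → (κ ≡ stair → a < p) →
                    inversionsKinds p n κ (tower r) a b ≡ credit κ r
inversions-credit p n stair (ℓ , ρ') {a} {b} a<b b<n stair⇒a<p
  rewrite ≡ᵇ-false (<⇒≢ (≤-trans (stair⇒a<p refl) (p≤laneDiag p ℓ)))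
        | ≡ᵇ-false (<⇒≢ (≤-trans (stair⇒a<p refl) (≤-trans (p≤laneDiag p ℓ) (n≤1+n _))))
  = cong₂ _+_ (ind-∧false (carOfKind n stair a <ᵇ carOfKind n (tower (ℓ , ρ')) b))
              (ind-∧false (carOfKind n (tower (ℓ , ρ')) b <ᵇ carOfKind n stair a))
inversions-credit p n (tower (low , ρ)) (low , ρ') a<b b<n _
  rewrite same-lane-car n low ρ ρ' a<b b<n | ≡ᵇ-refl p | ≡ᵇ-false (<⇒≢ (n<1+n p))
  = trans (cong (_+_ (ind (isRising ρ' ∧ not (isMark ρ)))) (ind-∧false _))
          (trans (+-identityʳ _) (credit-same-lane low ρ ρ'))
inversions-credit p n (tower (high , ρ)) (high , ρ') a<b b<n _
  rewrite same-lane-car n high ρ ρ' a<b b<n | ≡ᵇ-refl p | ≡ᵇ-false (<⇒≢ (n<1+n p))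
  = trans (cong (_+_ (ind (isRising ρ' ∧ not (isMark ρ)))) (ind-∧false _))
          (trans (+-identityʳ _) (credit-same-lane high ρ ρ'))
inversions-credit p n (tower (high , ρ)) (low , ρ') a<b b<n _
  rewrite <ᵇ-true (low<high n ρ' ρ b<n (<-trans a<b b<n)) | ≡ᵇ-false (<⇒≢ (n<1+n p) ∘ sym) | ≡ᵇ-refl p
  = trans (cong (_+ freeInd ρ) (ind-∧false _)) (credit-high-low ρ ρ')
inversions-credit p n (tower (low , ρ)) (high , ρ') {a} {b} a<b b<n _
  rewrite ≡ᵇ-false (<⇒≢ (n<1+n p)) | ≡ᵇ-false (<⇒≢ (≤-trans (n<1+n p) (n≤1+n (suc p))))
  = trans (cong₂ _+_ (ind-∧false (carOfKind n (tower (low , ρ)) a <ᵇ carOfKind n (tower (high , ρ')) b))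
                     (ind-∧false (carOfKind n (tower (high , ρ')) b <ᵇ carOfKind n (tower (low , ρ)) a)))
          (sym (credit-low-high ρ ρ'))

gain-single : ∀ r r' g → gain r (single r' g) ≡ credit (tower r') r
gain-single (low  , rise) r' g = refl
gain-single (low  , mark) r' g = refl
gain-single (low  , fall) r' g = refl
gain-single (high , rise) r' g = refl
gain-single (high , mark) r' g = refl
gain-single (high , fall) r' g = refl

-- A tower is valid when its bottom row is a rising low row (so that it
-- continues the staircase) and every mark sits on a row whose lane is at
-- least as high (so that the mark is at a valley of the path).

_≼_ : Lane → Lane → Set
low  ≼ _    = ⊤
high ≼ low  = ⊥
high ≼ high = ⊤

topLane : List Row → Lane
topLane []            = low
topLane ((ℓ , _) ∷ _) = ℓ

Supports : List Row → Row → Set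
Supports R (ℓ , mark) = ℓ ≼ topLane R
Supports R (ℓ , rise) = ⊤
Supports R (ℓ , fall) = ⊤

data Valid : List Row → Set where
  ground : Valid ((low , rise) ∷ [])
  stack  : ∀ {R r} → Valid R → Supports R r → Valid (r ∷ R)

-- the row at height j of a tower, counted from the bottom
rowAt : List Row → ℕ → Row
rowAt []      j = (low , rise)
rowAt (r ∷ R) j = if j ≡ᵇ length R then r else rowAt R j

rowAt-below : ∀ r R j → j < length R → rowAt (r ∷ R) j ≡ rowAt R j
rowAt-below r R j j<l rewrite ≡ᵇ-false (<⇒≢ j<l) = refl

rowAt-top : ∀ r R → rowAt (r ∷ R) (length R) ≡ r
rowAt-top r R rewrite ≡ᵇ-refl (length R) = refl

valid-nonempty : ∀ {R} → Valid R → 0 < length R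
valid-nonempty ground      = s≤s z≤n
valid-nonempty (stack _ _) = s≤s z≤n

valid-bottom : ∀ {R} → Valid R → rowAt R 0 ≡ (low , rise)
valid-bottom ground                  = refl
valid-bottom (stack {R} {r} valid _) = trans (rowAt-below r R 0 (valid-nonempty valid)) (valid-bottom valid)

valid-mark : ∀ {R} → Valid R → ∀ j ℓ → suc j < length R → rowAt R (suc j) ≡ (ℓ , mark) →
             ℓ ≼ proj₁ (rowAt R j)
valid-mark ground j ℓ (s≤s ()) _
valid-mark (stack {R} {r} valid supported) j ℓ sj<l isMarkRow with m≤n⇒m<n∨m≡n (≤-pred sj<l)
... | inj₁ sj<R = subst (λ r' → ℓ ≼ proj₁ r') (sym (rowAt-below r R j (<-trans (n<1+n j) sj<R)))
                    (valid-mark valid j ℓ sj<R (trans (sym (rowAt-below r R (suc j) sj<R)) isMarkRow))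
... | inj₂ sj≡l = subst (ℓ ≼_) (sym below-is-top) (subst (Supports R) r-is-mark supported)
  where
    r-is-mark : r ≡ (ℓ , mark)
    r-is-mark = trans (sym (rowAt-top r R)) (trans (cong (rowAt (r ∷ R)) (sym sj≡l)) isMarkRow)
    top-lane : ∀ R j → suc j ≡ length R → proj₁ (rowAt R j) ≡ topLane R
    top-lane (r' ∷ R') j eq rewrite suc-injective eq = cong proj₁ (rowAt-top r' R')
    below-is-top : proj₁ (rowAt (r ∷ R) j) ≡ topLane R
    below-is-top = trans (cong proj₁ (rowAt-below r R j (subst (j <_) sj≡l (n<1+n j)))) (top-lane R j sj≡l)

module Staircase (p : ℕ) where
  open ≡-Reasoning

  kindAt : List Row → ℕ → Kind
  kindAt R k = if k <ᵇ p then stair else tower (rowAt R (k ∸ p))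

  kindAt-stair : ∀ R {k} → k < p → kindAt R k ≡ stair
  kindAt-stair R k<p rewrite <ᵇ-true k<p = refl

  kindAt-stair⁻¹ : ∀ R k → kindAt R k ≡ stair → k < p
  kindAt-stair⁻¹ R k eq with k <ᵇ p in k<ᵇp
  ... | true  = <ᵇ-sound k<ᵇp
  ... | false with () ← eq

  kindAt-tower : ∀ R j → kindAt R (j + p) ≡ tower (rowAt R j)
  kindAt-tower R j rewrite <ᵇ-false (m≤n+m p j) | m+n∸n≡m j p = refl

  kindAt-below : ∀ r R k → k < length R + p → kindAt (r ∷ R) k ≡ kindAt R k
  kindAt-below r R k k<n with k <ᵇ p in k<ᵇp
  ... | true  = refl
  ... | false = cong tower (rowAt-below r R (k ∸ p) j<l)
    where
      p≤k : p ≤ k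
      p≤k = ≮⇒≥ (λ k<p → subst T k<ᵇp (<⇒<ᵇ k<p))
      j<l : k ∸ p < length R
      j<l = subst (k ∸ p <_) (m+n∸n≡m (length R) p) (∸-monoˡ-< k<n p≤k)

  kindAt-top : ∀ r R → kindAt (r ∷ R) (length R + p) ≡ tower r
  kindAt-top r R = trans (kindAt-tower (r ∷ R) (length R)) (cong tower (rowAt-top r R))

  tower-sum : ∀ (f : Kind → ℕ) (F : List Row → ℕ) → f stair ≡ 0 → F [] ≡ 0 →
              (∀ r R → F (r ∷ R) ≡ F R + f (tower r)) →
              ∀ R → sum< (length R + p) (λ k → f (kindAt R k)) ≡ F R
  tower-sum f F f-stair F-empty F-step [] =
    trans (sum<-zero p _ (λ k k<p → trans (cong f (kindAt-stair [] k<p)) f-stair)) (sym F-empty)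
  tower-sum f F f-stair F-empty F-step (r ∷ R) = begin
    sum< (suc (length R + p)) (λ k → f (kindAt (r ∷ R) k))
      ≡⟨ sum<-snoc (length R + p) _ ⟩
    sum< (length R + p) (λ k → f (kindAt (r ∷ R) k)) + f (kindAt (r ∷ R) (length R + p))
      ≡⟨ cong₂ _+_ (sum<-cong (length R + p) (λ k k<n → cong f (kindAt-below r R k k<n)))
                   (cong f (kindAt-top r R)) ⟩
    sum< (length R + p) (λ k → f (kindAt R k)) + f (tower r)
      ≡⟨ cong (_+ f (tower r)) (tower-sum f F f-stair F-empty F-step R) ⟩
    F R + f (tower r)
      ≡⟨ F-step r R ⟨
    F (r ∷ R) ∎

  marks-sum : ∀ R → sum< (length R + p) (λ k → ind (markOfKind (kindAt R k))) ≡ marks (profileOf R)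
  marks-sum = tower-sum (λ κ → ind (markOfKind κ)) (λ R → marks (profileOf R)) refl refl (λ _ _ → refl)

  credit-sum : ∀ r R → sum< (length R + p) (λ k → credit (kindAt R k) r) ≡ gain r (profileOf R)
  credit-sum r = tower-sum (λ κ → credit κ r) (λ R → gain r (profileOf R)) refl (gain-empty r)
    (λ r' R → trans (gain-⊕ r (profileOf R) _) (cong (_+_ (gain r (profileOf R))) (gain-single r r' _)))

  laneDiag-highs : ∀ ℓ → laneDiag p ℓ ≡ p + onHigh ℓ 1
  laneDiag-highs low  = sym (+-identityʳ p)
  laneDiag-highs high = sym (+-comm p 1)

  diag-sum : ∀ R → sum< (length R + p) (λ k → diagOfKind p (kindAt R k) k)
                   ≡ tri p + (p * length R + highs (profileOf R))
  diag-sum [] = begin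
    sum< p (λ k → diagOfKind p (kindAt [] k) k) ≡⟨ sum<-cong p (λ k k<p → cong (λ κ → diagOfKind p κ k) (kindAt-stair [] k<p)) ⟩
    sum< p (λ k → k)                            ≡⟨ sum<-id p ⟩
    tri p                                       ≡⟨ trans (cong (_+_ (tri p)) (trans (+-identityʳ _) (*-zeroʳ p))) (+-identityʳ (tri p)) ⟨
    tri p + (p * 0 + 0)                         ∎
  diag-sum ((ℓ , ρ) ∷ R) = begin
    sum< (suc (length R + p)) (λ k → diagOfKind p (kindAt ((ℓ , ρ) ∷ R) k) k)
      ≡⟨ sum<-snoc (length R + p) _ ⟩
    sum< (length R + p) (λ k → diagOfKind p (kindAt ((ℓ , ρ) ∷ R) k) k)
      + diagOfKind p (kindAt ((ℓ , ρ) ∷ R) (length R + p)) (length R + p)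
      ≡⟨ cong₂ _+_ (sum<-cong (length R + p) (λ k k<n → cong (λ κ → diagOfKind p κ k) (kindAt-below (ℓ , ρ) R k k<n)))
                   (trans (cong (λ κ → diagOfKind p κ (length R + p)) (kindAt-top (ℓ , ρ) R)) (laneDiag-highs ℓ)) ⟩
    sum< (length R + p) (λ k → diagOfKind p (kindAt R k) k) + (p + onHigh ℓ 1)
      ≡⟨ cong (_+ (p + onHigh ℓ 1)) (diag-sum R) ⟩
    tri p + (p * length R + highs (profileOf R)) + (p + onHigh ℓ 1)
      ≡⟨ regroup (tri p) p (length R) (highs (profileOf R)) (onHigh ℓ 1) ⟩
    tri p + (p * suc (length R) + (highs (profileOf R) + onHigh ℓ 1)) ∎
    where
      regroup : ∀ t p l h d → t + (p * l + h) + (p + d) ≡ t + (p * suc l + (h + d))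
      regroup = solve-∀

  -- the diagonal inversions: those of the tower (the staircase forms none)
  inversions-sum : ∀ n R → length R + p ≤ n →
    pairSum (length R + p) (λ a b → inversionsKinds p n (kindAt R a) (kindAt R b) a b) ≡ pairs (profileOf R)
  inversions-sum n [] _ = pairSum-zero p _ (λ a b a<b b<p → begin
    inversionsKinds p n (kindAt [] a) (kindAt [] b) a b
      ≡⟨ cong₂ (λ κ κ' → inversionsKinds p n κ κ' a b) (kindAt-stair [] (<-trans a<b b<p)) (kindAt-stair [] b<p) ⟩
    inversionsKinds p n stair stair a b
      ≡⟨ cong₂ _+_ (cong (λ e → ind ((carOfKind n stair a <ᵇ carOfKind n stair b) ∧ (e ∧ true))) (≡ᵇ-false (<⇒≢ a<b)))
                   (cong (λ e → ind ((carOfKind n stair b <ᵇ carOfKind n stair a) ∧ (e ∧ true))) (≡ᵇ-false (<⇒≢ (m<n⇒m<1+n a<b)))) ⟩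
    ind ((carOfKind n stair a <ᵇ carOfKind n stair b) ∧ false) + ind ((carOfKind n stair b <ᵇ carOfKind n stair a) ∧ false)
      ≡⟨ cong₂ _+_ (ind-∧false (carOfKind n stair a <ᵇ carOfKind n stair b))
                   (ind-∧false (carOfKind n stair b <ᵇ carOfKind n stair a)) ⟩
    0 ∎)
  inversions-sum n (r ∷ R) size≤n = cong₂ _+_ (trans lower-pairs (inversions-sum n R (≤-trans (n≤1+n _) size≤n))) new-pairs
    where
      m = length R + p
      X : List Row → ℕ → ℕ → ℕ
      X R' a b = inversionsKinds p n (kindAt R' a) (kindAt R' b) a b
      lower-pairs : pairSum m (X (r ∷ R)) ≡ pairSum m (X R)
      lower-pairs = pairSum-cong m (λ a b a<b b<m →
        cong₂ (λ κ κ' → inversionsKinds p n κ κ' a b) (kindAt-below r R a (<-trans a<b b<m)) (kindAt-below r R b b<m))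
      new-pairs : sum< m (λ a → X (r ∷ R) a m) ≡ gain r (profileOf R)
      new-pairs = begin
        sum< m (λ a → X (r ∷ R) a m)
          ≡⟨ sum<-cong m (λ a a<m → begin
               X (r ∷ R) a m
                 ≡⟨ cong (λ κ → inversionsKinds p n (kindAt (r ∷ R) a) κ a m) (kindAt-top r R) ⟩
               inversionsKinds p n (kindAt (r ∷ R) a) (tower r) a m
                 ≡⟨ inversions-credit p n (kindAt (r ∷ R) a) r a<m size≤n (kindAt-stair⁻¹ (r ∷ R) a) ⟩
               credit (kindAt (r ∷ R) a) r
                 ≡⟨ cong (λ κ → credit κ r) (kindAt-below r R a a<m) ⟩
               credit (kindAt R a) r ∎) ⟩
        sum< m (λ a → credit (kindAt R a) r)
          ≡⟨ credit-sum r R ⟩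
        gain r (profileOf R) ∎

  data Edge (k : ℕ) : Set where
    inStair : suc k < p → Edge k
    atBase  : suc k ≡ p → Edge k
    inTower : ∀ j → k ≡ j + p → Edge k

  edge : ∀ k → Edge k
  edge k with <-cmp (suc k) p
  ... | tri< sk<p _ _ = inStair sk<p
  ... | tri≈ _ sk≡p _ = atBase sk≡p
  ... | tri> _ _ p<sk = inTower (k ∸ p) (sym (m∸n+n≡m (≤-pred p<sk)))

  laneDiag≤ : ∀ ℓ → laneDiag p ℓ ≤ suc p
  laneDiag≤ low  = n≤1+n p
  laneDiag≤ high = ≤-refl

  -- the diagonal rises between consecutive tower rows only from lane low
  -- to lane high, where the car rises too
  tower-column : ∀ n r r' {a b} → a < n → b < n → laneDiag p (proj₁ r') ≡ suc (laneDiag p (proj₁ r)) →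
                 carOfKind n (tower r) a < carOfKind n (tower r') b
  tower-column n (low  , ρ) (high , ρ') a<n b<n _  = low<high n ρ ρ' a<n b<n
  tower-column n (low  , ρ) (low  , ρ') a<n b<n eq = ⊥-elim (1+n≢n (sym eq))
  tower-column n (high , ρ) (high , ρ') a<n b<n eq = ⊥-elim (1+n≢n (sym (suc-injective eq)))
  tower-column n (high , ρ) (low  , ρ') a<n b<n eq = ⊥-elim (<⇒≢ (≤-trans (n<1+n p) (n≤1+n _)) eq)

  mark-on : ∀ n ℓ ℓ' ρ {a b} → a < b → b < n → ℓ' ≼ ℓ →
            laneDiag p ℓ' ≤ laneDiag p ℓ ×
            (laneDiag p ℓ' ≡ laneDiag p ℓ → carOfKind n (tower (ℓ , ρ)) a < carOfKind n (tower (ℓ' , mark)) b)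
  mark-on n low  low  ρ a<b b<n _ = ≤-refl , λ _ → <ᵇ-sound (same-lane-car n low ρ mark a<b b<n)
  mark-on n high high ρ a<b b<n _ = ≤-refl , λ _ → <ᵇ-sound (same-lane-car n high ρ mark a<b b<n)
  mark-on n high low  ρ a<b b<n _ = n≤1+n p , λ eq → ⊥-elim (<⇒≢ (n<1+n p) eq)

  module OfTower (R : List Row) (valid : Valid R) where
    n : ℕ
    n = length R + p

    diagAt carAt : ℕ → ℕ
    diagAt k = diagOfKind p (kindAt R k) k
    carAt  k = carOfKind n (kindAt R k) k

    markAt : ℕ → Bool
    markAt k = markOfKind (kindAt R k)

    base-kind : ∀ {k} → k ≡ p → kindAt R k ≡ tower (low , rise)
    base-kind k≡p = trans (cong (kindAt R) k≡p) (trans (kindAt-tower R 0) (cong tower (valid-bottom valid)))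

    diag-start : diagAt 0 ≡ 0
    diag-start with m≤n⇒m<n∨m≡n (z≤n {p})
    ... | inj₁ 0<p = cong (λ κ → diagOfKind p κ 0) (kindAt-stair R 0<p)
    ... | inj₂ 0≡p = trans (cong (λ κ → diagOfKind p κ 0) (base-kind 0≡p)) (sym 0≡p)

    start-unmarked : markAt 0 ≡ false
    start-unmarked with m≤n⇒m<n∨m≡n (z≤n {p})
    ... | inj₁ 0<p = cong markOfKind (kindAt-stair R 0<p)
    ... | inj₂ 0≡p = cong markOfKind (base-kind 0≡p)

    diag-step : ∀ k → suc k < n → diagAt (suc k) ≤ suc (diagAt k)
    diag-step k _ with edge k
    ... | inStair sk<p rewrite kindAt-stair R (<-trans (n<1+n k) sk<p) | kindAt-stair R sk<p = ≤-refl
    ... | atBase sk≡p rewrite kindAt-stair R (subst (k <_) sk≡p (n<1+n k)) | base-kind sk≡p = ≤-reflexive (sym sk≡p)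
    ... | inTower j refl rewrite kindAt-tower R j | kindAt-tower R (suc j) =
          ≤-trans (laneDiag≤ _) (s≤s (p≤laneDiag p _))

    car-column : ∀ k → suc k < n → diagAt (suc k) ≡ suc (diagAt k) → carAt k < carAt (suc k)
    car-column k sk<n rises with edge k
    ... | inStair sk<p rewrite kindAt-stair R (<-trans (n<1+n k) sk<p) | kindAt-stair R sk<p =
          carIn-climbing n 1 k (suc k) refl (n<1+n k)
    ... | atBase sk≡p rewrite kindAt-stair R (subst (k <_) sk≡p (n<1+n k)) | base-kind sk≡p =
          carIn-climbing n 1 k (suc k) refl (n<1+n k)
    ... | inTower j refl rewrite kindAt-tower R j | kindAt-tower R (suc j) =
          tower-column n (rowAt R j) (rowAt R (suc j)) (<-trans (n<1+n _) sk<n) sk<n rises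

    mark-valley : ∀ k → suc k < n → markAt (suc k) ≡ true →
                  diagAt (suc k) ≤ diagAt k × (diagAt (suc k) ≡ diagAt k → carAt k < carAt (suc k))
    mark-valley k sk<n marked with edge k
    ... | inStair sk<p rewrite kindAt-stair R sk<p with () ← marked
    ... | atBase sk≡p rewrite base-kind sk≡p with () ← marked
    ... | inTower j refl rewrite kindAt-tower R j | kindAt-tower R (suc j)
      with rowAt R (suc j) in top | marked
    ... | (ℓ' , mark) | _ =
          mark-on n (proj₁ (rowAt R j)) ℓ' (proj₂ (rowAt R j)) (n<1+n _) sk<n
            (valid-mark valid j ℓ' (+-cancelʳ-< p (suc j) (length R) sk<n) top)

    blueprint : Blueprint n
    blueprint = record
      { diagOf = diagAt ; carOf = carAt ; markOf = markAt
      ; diag-start = diag-start ; diag-step = diag-step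
      ; car-pos = λ k k<n → carIn-pos n (band (kindAt R k)) k k<n
      ; car-inj = λ i j i<n j<n → carIn-injective n (band (kindAt R i)) (band (kindAt R j)) i j i<n j<n
      ; car-column = car-column
      ; start-unmarked = start-unmarked ; mark-valley = mark-valley }

tower-MPF : ∀ p R → Valid R →
  Σ (MPF (length R + p)) λ M → area M ≡ tri p + (p * length R + highs (profileOf R))
                             × primary M + secondary M ≡ pairs (profileOf R)
                             × numMarked M ≡ marks (profileOf R)
tower-MPF p R valid with realize blueprint
  where open Staircase p
        open OfTower R valid
... | M , area≡ , inversions≡ , marks≡ =
  M , trans area≡ (diag-sum R) , trans inversions≡ (inversions-sum (length R + p) R ≤-refl) , trans marks≡ (marks-sum R)
  where open Staircase p

profile-≡ : ∀ {a b c d e f a' b' c' d' e' f'} → a ≡ a' → b ≡ b' → c ≡ c' → d ≡ d' → e ≡ e' → f ≡ f' →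
            profile a b c d e f ≡ profile a' b' c' d' e' f'
profile-≡ refl refl refl refl refl refl = refl

⊕-assoc : ∀ P Q S → (P ⊕ Q) ⊕ S ≡ P ⊕ (Q ⊕ S)
⊕-assoc P Q S = profile-≡ (+-assoc (size P) _ _) (+-assoc (highs P) _ _) (+-assoc (marks P) _ _)
                          (+-assoc (free P) _ _) (+-assoc (freeHigh P) _ _) (+-assoc (pairs P) _ _)

freeFrom-⊕ : ∀ ℓ P Q → freeFrom ℓ (P ⊕ Q) ≡ freeFrom ℓ P + freeFrom ℓ Q
freeFrom-⊕ low  P Q = refl
freeFrom-⊕ high P Q = refl

freeAbove-⊕ : ∀ ℓ P Q → freeAbove ℓ (P ⊕ Q) ≡ freeAbove ℓ P + freeAbove ℓ Q
freeAbove-⊕ low  P Q = refl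
freeAbove-⊕ high P Q = refl

onHigh-+ : ∀ ℓ a b → onHigh ℓ a + onHigh ℓ b ≡ onHigh ℓ (a + b)
onHigh-+ low  a b = refl
onHigh-+ high a b = refl

Realizable : Profile → Set
Realizable P = Σ (List Row) λ R → Valid R × profileOf R ≡ P

grow : ∀ {R} Q Δ r g → profileOf R ≡ Q ⊕ Δ → gain r (Q ⊕ Δ) ≡ g →
       profileOf (r ∷ R) ≡ Q ⊕ (Δ ⊕ single r g)
grow {R} Q Δ r g prof gain≡ = begin
  profileOf R ⊕ single r (gain r (profileOf R)) ≡⟨ cong (λ P → P ⊕ single r (gain r P)) prof ⟩
  (Q ⊕ Δ) ⊕ single r (gain r (Q ⊕ Δ))           ≡⟨ cong (λ g → (Q ⊕ Δ) ⊕ single r g) gain≡ ⟩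
  (Q ⊕ Δ) ⊕ single r g                          ≡⟨ ⊕-assoc Q Δ _ ⟩
  Q ⊕ (Δ ⊕ single r g)                          ∎
  where open ≡-Reasoning

-- A stack in lane ℓ: s + 1 free rows and m marks of lane ℓ, forming B
-- inversions among themselves.
stackΔ : Lane → ℕ → ℕ → ℕ → Profile
stackΔ ℓ s m B = profile (suc s + m) (onHigh ℓ (suc s + m)) m (suc s) (onHigh ℓ (suc s)) B

freeFrom-stackΔ : ∀ ℓ s m B → freeFrom ℓ (stackΔ ℓ s m B) ≡ suc s
freeFrom-stackΔ low  s m B = refl
freeFrom-stackΔ high s m B = refl

freeAbove-stackΔ : ∀ ℓ s m B → freeAbove ℓ (stackΔ ℓ s m B) ≡ 0
freeAbove-stackΔ low  s m B = refl
freeAbove-stackΔ high s m B = refl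

stackΔ-mark : ∀ ℓ s m B → stackΔ ℓ s m B ⊕ single (ℓ , mark) (suc s) ≡ stackΔ ℓ s (suc m) (B + suc s)
stackΔ-mark ℓ s m B = profile-≡ size≡ (trans (onHigh-+ ℓ _ 1) (cong (onHigh ℓ) size≡)) (+-comm m 1)
                                (+-identityʳ (suc s)) (trans (onHigh-+ ℓ _ 0) (cong (onHigh ℓ) (+-identityʳ (suc s)))) refl
  where size≡ : suc s + m + 1 ≡ suc s + suc m
        size≡ = trans (+-comm (suc s + m) 1) (cong suc (sym (+-suc s m)))

stackΔ-rise : ∀ ℓ s B → stackΔ ℓ s 0 B ⊕ single (ℓ , rise) (suc s) ≡ stackΔ ℓ (suc s) 0 (B + suc s)
stackΔ-rise ℓ s B = profile-≡ (+-comm (suc s + 0) 1) (trans (onHigh-+ ℓ _ 1) (cong (onHigh ℓ) (+-comm (suc s + 0) 1)))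
                              refl (+-comm (suc s) 1) (trans (onHigh-+ ℓ _ 1) (cong (onHigh ℓ) (+-comm (suc s) 1))) refl

stackΔ-fall : ∀ ℓ s m B → stackΔ ℓ s m B ⊕ single (ℓ , fall) 0 ≡ stackΔ ℓ (suc s) m B
stackΔ-fall ℓ s m B = profile-≡ (+-comm (suc s + m) 1) (trans (onHigh-+ ℓ _ 1) (cong (onHigh ℓ) (+-comm (suc s + m) 1)))
                                (+-identityʳ m) (+-comm (suc s) 1) (trans (onHigh-+ ℓ _ 1) (cong (onHigh ℓ) (+-comm (suc s) 1)))
                                (+-identityʳ B)

≼-refl : ∀ ℓ → ℓ ≼ ℓ
≼-refl low  = _
≼-refl high = _

Stacked : Lane → Profile → ℕ → ℕ → ℕ → Set
Stacked ℓ P s m B = Σ (List Row) λ R → Valid R × topLane R ≡ ℓ × profileOf R ≡ P ⊕ stackΔ ℓ s m B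

-- Placing a mark, a rising or a falling row of lane ℓ on top of a stack,
-- when the rows below the stack contribute nothing to its gain.
module PushOnStack (ℓ : Lane) (P : Profile) (noFree : freeFrom ℓ P ≡ 0) (noAbove : freeAbove ℓ P ≡ 0) where

  gain-rising : ∀ s m B → freeFrom ℓ (P ⊕ stackΔ ℓ s m B) ≡ suc s
  gain-rising s m B = trans (freeFrom-⊕ ℓ P _) (cong₂ _+_ noFree (freeFrom-stackΔ ℓ s m B))

  gain-falling : ∀ s m B → freeAbove ℓ (P ⊕ stackΔ ℓ s m B) ≡ 0
  gain-falling s m B = trans (freeAbove-⊕ ℓ P _) (cong₂ _+_ noAbove (freeAbove-stackΔ ℓ s m B))

  push-mark : ∀ s m B → Stacked ℓ P s m B → Stacked ℓ P s (suc m) (B + suc s)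
  push-mark s m B (R , valid , top , prof) =
    (ℓ , mark) ∷ R , stack valid (subst (ℓ ≼_) (sym top) (≼-refl ℓ)) , refl ,
    trans (grow P _ (ℓ , mark) (suc s) prof (gain-rising s m B)) (cong (P ⊕_) (stackΔ-mark ℓ s m B))

  push-rise : ∀ s B → Stacked ℓ P s 0 B → Stacked ℓ P (suc s) 0 (B + suc s)
  push-rise s B (R , valid , top , prof) =
    (ℓ , rise) ∷ R , stack valid _ , refl ,
    trans (grow P _ (ℓ , rise) (suc s) prof (gain-rising s 0 B)) (cong (P ⊕_) (stackΔ-rise ℓ s B))

  push-fall : ∀ s m B → Stacked ℓ P s m B → Stacked ℓ P (suc s) m B
  push-fall s m B (R , valid , top , prof) =
    (ℓ , fall) ∷ R , stack valid _ , refl ,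
    trans (grow P _ (ℓ , fall) 0 prof (gain-falling s m B)) (cong (P ⊕_) (stackΔ-fall ℓ s m B))

∸-lower : ∀ g x B → g + x ≤ B → x ≤ B ∸ g
∸-lower g x B le = subst (_≤ B ∸ g) (m+n∸m≡n g x) (∸-monoˡ-≤ g le)

∸-upper : ∀ g c B → B ≤ g + c → B ∸ g ≤ c
∸-upper g c B le = subst (B ∸ g ≤_) (m+n∸m≡n g c) (∸-monoˡ-≤ g le)

mark-bounds : ∀ s m B → suc s + m ≤ B → B ≤ tri (suc s) + suc m * suc s →
              m ≤ B ∸ suc s × B ∸ suc s ≤ tri (suc s) + m * suc s
mark-bounds s m B enough B≤ =
  ∸-lower (suc s) m B enough , ∸-upper (suc s) _ B (≤-trans B≤ (≤-reflexive (regroup (tri (suc s)) s m)))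
  where
    regroup : ∀ t s m → t + suc m * suc s ≡ suc s + (t + m * suc s)
    regroup = solve-∀

rise-bounds : ∀ s B → B ≤ tri (suc (suc s)) + 0 → B ∸ suc s ≤ tri (suc s) + 0
rise-bounds s B B≤ = ∸-upper (suc s) _ B (≤-trans B≤ (≤-reflexive (regroup (tri (suc s)) s)))
  where
    regroup : ∀ t s → t + suc s + 0 ≡ suc s + (t + 0)
    regroup = solve-∀

fall-bounds : ∀ s m B → B < suc s + m → B ≤ tri (suc s) + m * suc s
fall-bounds s m B short = ≤-trans (≤-pred short) (+-mono-≤ s≤tri (m≤m*n m (suc s)))
  where
    s≤tri : s ≤ tri (suc s)
    s≤tri = m≤n+m s (tri s)

-- Greedily from the top: a mark on top pairs with all s + 1 free
-- rows; when the marks are used up or too costly the top row is free,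
-- rising (pairing with the s free rows below) or falling (pairing with none).
stack-on : ∀ ℓ {R} → Valid ((ℓ , rise) ∷ R) → freeFrom ℓ (profileOf R) ≡ 0 → freeAbove ℓ (profileOf R) ≡ 0 →
           ∀ s m B → m ≤ B → B ≤ tri (suc s) + m * suc s → Stacked ℓ (profileOf R) s m B
stack-on ℓ {R} start noFree noAbove = build
  where
    open PushOnStack ℓ (profileOf R) noFree noAbove

    build : ∀ s m B → m ≤ B → B ≤ tri (suc s) + m * suc s → Stacked ℓ (profileOf R) s m B
    build zero zero B _ B≤0 =
      (ℓ , rise) ∷ R , start , refl ,
      cong (λ g → profileOf R ⊕ single (ℓ , rise) g) (trans noFree (sym (n≤0⇒n≡0 B≤0)))
    build s (suc m) B m≤B B≤ with suc s + m ≤? B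
    ... | yes enough = subst (Stacked ℓ (profileOf R) s (suc m)) (m∸n+n≡m (≤-trans (m≤m+n (suc s) m) enough))
          (push-mark s m (B ∸ suc s) (build s m (B ∸ suc s) (proj₁ bounds) (proj₂ bounds)))
      where bounds = mark-bounds s m B enough B≤
    build zero (suc m) B m≤B B≤ | no short = ⊥-elim (short m≤B)
    build (suc s) (suc m) B m≤B B≤ | no short =
      push-fall s (suc m) B (build s (suc m) B m≤B (fall-bounds s (suc m) B (subst (B <_) (sym (+-suc (suc s) m)) (≰⇒> short))))
    build (suc s) zero B _ B≤ with suc s ≤? B
    ... | yes enough = subst (Stacked ℓ (profileOf R) (suc s) 0) (m∸n+n≡m enough)
          (push-rise s (B ∸ suc s) (build s 0 (B ∸ suc s) z≤n (rise-bounds s B B≤)))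
    ... | no short = push-fall s 0 B (build s 0 B z≤n (fall-bounds s 0 B (subst (B <_) (sym (+-identityʳ (suc s))) (≰⇒> short))))

-- the profile of a tower with w + 1 free low rows, v free high rows, mz low
-- marks and mo high marks, forming B inversions
shape : ℕ → ℕ → ℕ → ℕ → ℕ → Profile
shape w v mz mo B = profile (suc w + v + mz + mo) (v + mo) (mz + mo) (suc w + v) v B

-- the most inversions inside a low stack (w + 1 free rows, mz marks) and a
-- high stack (v free rows, mo marks)
lowStack highStack : ℕ → ℕ → ℕ
lowStack  w mz = tri (suc w) + mz * suc w
highStack v mo = tri v + mo * v

-- the most inversions of a tower of shape w v mz mo: besides those inside
-- the two stacks, each low row above the bottom one may pair with each free
-- high row below it
capacity : ℕ → ℕ → ℕ → ℕ → ℕ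
capacity w v mz mo = lowStack w mz + highStack v mo + v * (w + mz)

capacity-mark : ∀ w v mz mo → capacity w v (suc mz) mo ≡ (suc w + v) + capacity w v mz mo
capacity-mark w v mz mo = regroup (tri (suc w)) (tri v) w v mz mo
  where
    regroup : ∀ t t' w v mz mo → t + suc mz * suc w + (t' + mo * v) + v * (w + suc mz)
                                 ≡ (suc w + v) + (t + mz * suc w + (t' + mo * v) + v * (w + mz))
    regroup = solve-∀

capacity-rise : ∀ w v mo → capacity (suc w) v 0 mo ≡ (suc w + v) + capacity w v 0 mo
capacity-rise w v mo = regroup (tri (suc w)) (tri v) w v mo
  where
    regroup : ∀ t t' w v mo → t + suc w + 0 * suc (suc w) + (t' + mo * v) + v * (suc w + 0)
                              ≡ (suc w + v) + (t + 0 * suc w + (t' + mo * v) + v * (w + 0))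
    regroup = solve-∀

highStack-room : ∀ v mo → (v ≡ 0 → mo ≡ 0) → mo + v ≤ suc (highStack v mo)
highStack-room zero    mo noMarks rewrite noMarks refl = z≤n
highStack-room (suc v) mo _ = subst (_≤ suc (highStack (suc v) mo)) (sym (+-suc mo v))
  (s≤s (≤-trans (+-mono-≤ (m≤m*n mo (suc v)) (m≤n+m v (tri v))) (≤-reflexive (+-comm (mo * suc v) _))))

split : ∀ {x₁ y₁ x₂ y₂ B} → x₁ ≤ y₁ → x₂ ≤ y₂ → x₁ + x₂ ≤ B → B ≤ y₁ + y₂ →
        Σ ℕ λ b₁ → Σ ℕ λ b₂ → b₁ + b₂ ≡ B × (x₁ ≤ b₁ × b₁ ≤ y₁) × (x₂ ≤ b₂ × b₂ ≤ y₂)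
split {x₁} {y₁} {x₂} {y₂} {B} x₁≤y₁ x₂≤y₂ lower upper with B ∸ x₂ ≤? y₁
... | yes fits = B ∸ x₂ , x₂ , m∸n+n≡m x₂≤B , (x₁≤ , fits) , (≤-refl , x₂≤y₂)
  where
    x₂≤B = ≤-trans (m≤n+m x₂ x₁) lower
    x₁≤ = subst (_≤ B ∸ x₂) (m+n∸n≡m x₁ x₂) (∸-monoˡ-≤ x₂ lower)
... | no overflow = y₁ , B ∸ y₁ , m+[n∸m]≡n y₁≤B , (x₁≤y₁ , ≤-refl) , (x₂≤ , ∸-le)
  where
    y₁<B-x₂ = ≰⇒> overflow
    y₁≤B = ≤-trans (<⇒≤ y₁<B-x₂) (m∸n≤m B x₂)
    x₂≤ : x₂ ≤ B ∸ y₁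
    x₂≤ = subst (_≤ B ∸ y₁) (m+n∸m≡n y₁ x₂) (∸-monoˡ-≤ y₁
            (≤-trans (+-monoˡ-≤ x₂ (<⇒≤ y₁<B-x₂)) (≤-reflexive (m∸n+n≡m (≤-trans (m≤n+m x₂ x₁) lower)))))
    ∸-le : B ∸ y₁ ≤ y₂
    ∸-le = subst (B ∸ y₁ ≤_) (m+n∸m≡n y₁ y₂) (∸-monoˡ-≤ y₁ upper)

low-supported : ∀ R ρ → Supports R (low , ρ)
low-supported R rise = tt
low-supported R fall = tt
low-supported R mark = tt

push-low : ∀ ρ {P} → Realizable P → Realizable (P ⊕ single (low , ρ) (gain (low , ρ) P))
push-low ρ (R , valid , prof) =
  (low , ρ) ∷ R , stack valid (low-supported R ρ) , cong (λ P → P ⊕ single (low , ρ) (gain (low , ρ) P)) prof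

shape-mark : ∀ w v mz mo B → shape w v mz mo B ⊕ single (low , mark) (suc w + v) ≡ shape w v (suc mz) mo (B + (suc w + v))
shape-mark w v mz mo B = profile-≡ (count w v mz mo) (+-identityʳ (v + mo)) (+-comm (mz + mo) 1)
                                   (+-identityʳ (suc w + v)) (+-identityʳ v) refl
  where
    count : ∀ w v mz mo → suc w + v + mz + mo + 1 ≡ suc w + v + suc mz + mo
    count = solve-∀

shape-rise : ∀ w v mo B → shape w v 0 mo B ⊕ single (low , rise) (suc w + v) ≡ shape (suc w) v 0 mo (B + (suc w + v))
shape-rise w v mo B = profile-≡ (count w v mo) (+-identityʳ (v + mo)) (+-identityʳ mo) (+-comm (suc w + v) 1) (+-identityʳ v) refl
  where
    count : ∀ w v mo → suc w + v + 0 + mo + 1 ≡ suc (suc w) + v + 0 + mo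
    count = solve-∀

separate-stacks : ∀ w v mz mo B → (v ≡ 0 → mo ≡ 0) → mz + mo ≤ B → B ≤ lowStack w mz + highStack v mo →
                  Realizable (shape w v mz mo B)
separate-stacks w zero mz mo B noMarks lower upper rewrite noMarks refl
  with stack-on low {[]} ground refl refl w mz B (≤-trans (m≤m+n mz 0) lower)
         (≤-trans upper (≤-reflexive (+-identityʳ (lowStack w mz))))
... | R , valid , _ , prof = R , valid , trans prof (profile-≡ (count w mz) refl (sym (+-identityʳ mz)) (sym (+-identityʳ (suc w))) refl refl)
  where
    count : ∀ w mz → suc w + mz ≡ suc w + 0 + mz + 0
    count = solve-∀
separate-stacks w (suc v) mz mo B _ lower upper
  with split (≤-trans (m≤m*n mz (suc w)) (m≤n+m _ (tri (suc w)))) (≤-trans (m≤m*n mo (suc v)) (m≤n+m _ (tri (suc v)))) lower upper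
... | Bz , Bo , Bz+Bo≡B , (mz≤Bz , Bz≤) , (mo≤Bo , Bo≤)
  with stack-on low {[]} ground refl refl w mz Bz mz≤Bz Bz≤
... | R₁ , valid₁ , _ , prof₁
  with stack-on high {R₁} (stack valid₁ tt) (cong freeHigh prof₁) refl v mo Bo mo≤Bo Bo≤
... | R₂ , valid₂ , _ , prof₂ = R₂ , valid₂ , trans prof₂ (trans (cong (_⊕ stackΔ high v mo Bo) prof₁)
        (profile-≡ (count w v mz mo) refl refl refl refl Bz+Bo≡B))
  where
    count : ∀ w v mz mo → suc w + mz + (suc v + mo) ≡ suc w + suc v + mz + mo
    count = solve-∀

top-room : ∀ {a L} v mo → (v ≡ 0 → mo ≡ 0) → a ≤ L → a + (mo + v) ≤ suc (L + highStack v mo)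
top-room {a} {L} v mo noMarks a≤L =
  ≤-trans (+-mono-≤ a≤L (highStack-room v mo noMarks)) (≤-reflexive (+-suc L (highStack v mo)))

-- If it fits into two separate stacks, use
-- them; otherwise put a low mark (while marks remain) or a rising low row
-- on top of a smaller tower: it pairs with all free rows below.
two-lanes : ∀ w v mz mo B → (v ≡ 0 → mo ≡ 0) → mz + mo ≤ B → B ≤ capacity w v mz mo →
            Realizable (shape w v mz mo B)
two-lanes w v mz mo B noMarks lower upper with B ≤? lowStack w mz + highStack v mo
... | yes fits = separate-stacks w v mz mo B noMarks lower fits
two-lanes w v (suc mz) mo B noMarks lower upper | no over =
  subst Realizable (trans (shape-mark w v mz mo (B ∸ g)) (cong (shape w v (suc mz) mo) (m∸n+n≡m g≤B)))
    (push-low mark (two-lanes w v mz mo (B ∸ g) noMarks (∸-lower g _ B room) (∸-upper g _ B (subst (B ≤_) (capacity-mark w v mz mo) upper))))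
  where
    g = suc w + v
    room : g + (mz + mo) ≤ B
    room = ≤-trans (≤-reflexive (swap (suc w) v mz mo))
             (≤-trans (top-room v mo noMarks (≤-trans (+-monoʳ-≤ (suc w) (m≤m*n mz (suc w))) (m≤n+m _ (tri (suc w)))))
                      (≰⇒> over))
      where
        swap : ∀ a v mz mo → (a + v) + (mz + mo) ≡ (a + mz) + (mo + v)
        swap = solve-∀
    g≤B = ≤-trans (m≤m+n g _) room
two-lanes (suc w) v zero mo B noMarks lower upper | no over =
  subst Realizable (trans (shape-rise w v mo (B ∸ g)) (cong (shape (suc w) v 0 mo) (m∸n+n≡m g≤B)))
    (push-low rise (two-lanes w v 0 mo (B ∸ g) noMarks (∸-lower g _ B room) (∸-upper g _ B (subst (B ≤_) (capacity-rise w v mo) upper))))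
  where
    g = suc w + v
    room : g + mo ≤ B
    room = ≤-trans (≤-reflexive (swap (suc w) v mo))
             (≤-trans (top-room v mo noMarks (+-monoˡ-≤ 0 (m≤n+m (suc w) (tri (suc w))))) (≰⇒> over))
      where
        swap : ∀ a v mo → (a + v) + mo ≡ (a + 0) + (mo + v)
        swap = solve-∀
    g≤B = ≤-trans (m≤m+n g _) room
two-lanes zero v zero mo B noMarks lower upper | no over =
  ⊥-elim (over (≤-trans upper (≤-reflexive (trans (cong (_+_ (lowStack 0 0 + highStack v mo)) (*-zeroʳ v)) (+-identityʳ _)))))

tri-add : ∀ x y → tri (x + y) ≡ tri x + tri y + x * y
tri-add x zero    = trans (cong tri (+-identityʳ x)) (pad (tri x) x)
  where
    pad : ∀ t x → t ≡ t + 0 + x * 0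
    pad = solve-∀
tri-add x (suc y) = trans (cong tri (+-suc x y)) (trans (cong (_+ (x + y)) (tri-add x y)) (regroup (tri x) (tri y) x y))
  where
    regroup : ∀ tx ty x y → tx + ty + x * y + (x + y) ≡ tx + (ty + y) + x * suc y
    regroup = solve-∀

tri-mono : ∀ {x y} → x ≤ y → tri x ≤ tri y
tri-mono {zero}  _         = z≤n
tri-mono {suc x} (s≤s x≤y) = +-mono-≤ (tri-mono x≤y) x≤y

tri-reflect : ∀ x y → tri (suc x) ≤ tri (suc y) → x ≤ y
tri-reflect x y le = ≮⇒≥ (λ y<x → <⇒≱ (<-≤-trans (m<m+n (tri (suc y)) (s≤s z≤n)) (tri-mono (s≤s y<x))) le)

C2≡tri : ∀ m → m C 2 ≡ tri m
C2≡tri zero    = refl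
C2≡tri (suc m) = trans (sym (nCk+nC[k+1]≡[n+1]C[k+1] m 1)) (trans (cong₂ _+_ (nC1≡n m) (C2≡tri m)) (+-comm m (tri m)))

-- The area splits into a staircase of p rows (area tri p), a tower of t ≥ 1
-- rows each at least p above the diagonal (area p·t) and α high rows, with
-- room for them (α + 2 ≤ t, or α = 0).
record AreaSplit (n a : ℕ) : Set where
  constructor areaSplit
  field
    p t α    : ℕ
    p+t≡n    : p + t ≡ n
    1≤t      : 1 ≤ t
    area≡    : a ≡ tri p + p * t + α
    fewHighs : α + 2 ≤ t ⊎ α ≡ 0

-- An area below n - 1 fits into a tower of all n rows; a larger one
-- starts the staircase with one more row, which takes n - 1 of it.
area-split : ∀ n a → a ≤ tri (suc n) → AreaSplit (suc n) a
area-split zero    a a≤0 = areaSplit 0 1 0 refl (s≤s z≤n) (n≤0⇒n≡0 a≤0) (inj₂ refl)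
area-split (suc n) a a≤  = start-or-widen (suc n ≤? a)
  where
    widen : suc n ≤ a → AreaSplit (suc n) (a ∸ suc n) → AreaSplit (suc (suc n)) a
    widen large (areaSplit p t α p+t≡n 1≤t area≡ fewHighs) =
      areaSplit (suc p) t α (cong suc p+t≡n) 1≤t (begin
        a                                  ≡⟨ m∸n+n≡m large ⟨
        (a ∸ suc n) + suc n                ≡⟨ cong₂ _+_ area≡ (sym p+t≡n) ⟩
        (tri p + p * t + α) + (p + t)      ≡⟨ regroup (tri p) p t α ⟩
        tri (suc p) + suc p * t + α        ∎) fewHighs
      where
        open ≡-Reasoning
        regroup : ∀ x p t α → (x + p * t + α) + (p + t) ≡ (x + p) + (t + p * t) + α
        regroup = solve-∀

    start-or-widen : Dec (suc n ≤ a) → AreaSplit (suc (suc n)) a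
    start-or-widen (no small) = areaSplit 0 (suc (suc n)) a refl (s≤s z≤n) refl
      (inj₁ (subst (_≤ suc (suc n)) (+-comm 2 a) (s≤s (s≤s (≤-pred (≰⇒> small))))))
    start-or-widen (yes large) = widen large (area-split n (a ∸ suc n)
      (∸-upper (suc n) (tri (suc n)) a (≤-trans a≤ (≤-reflexive (+-comm (tri (suc n)) (suc n))))))

capacity-identity : ∀ w v mz mo →
  (v + mo) + capacity w v mz mo + mo * w + tri (suc (mz + mo)) ≡ tri (suc w + v + mz + mo) + (mz + mo)
capacity-identity w v mz mo = begin
  (v + mo) + capacity w v mz mo + mo * w + (tri (mz + mo) + (mz + mo))
    ≡⟨ expand (tri (suc w)) (tri v) (tri (mz + mo)) w v mz mo ⟩
  tri (suc w) + tri v + suc w * v + tri (mz + mo) + (suc w + v) * (mz + mo) + (mz + mo)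
    ≡⟨ cong (λ x → x + tri (mz + mo) + (suc w + v) * (mz + mo) + (mz + mo)) (tri-add (suc w) v) ⟨
  tri (suc w + v) + tri (mz + mo) + (suc w + v) * (mz + mo) + (mz + mo)
    ≡⟨ cong (_+ (mz + mo)) (tri-add (suc w + v) (mz + mo)) ⟨
  tri (suc w + v + (mz + mo)) + (mz + mo)
    ≡⟨ cong (λ x → tri x + (mz + mo)) (+-assoc (suc w + v) mz mo) ⟨
  tri (suc w + v + mz + mo) + (mz + mo) ∎
  where
    open ≡-Reasoning
    expand : ∀ T Tv Tc w v mz mo →
      (v + mo) + (T + mz * suc w + (Tv + mo * v) + v * (w + mz)) + mo * w + (Tc + (mz + mo))
      ≡ T + Tv + suc w * v + Tc + (suc w + v) * (mz + mo) + (mz + mo)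
    expand = solve-∀

-- If high marks only occur without extra low rows (mo · w = 0), the
-- capacity is exactly what the budget allows.
capacity-fits : ∀ w v mz mo b → mo * w ≡ 0 →
  (v + mo) + b + tri (suc (mz + mo)) ≤ tri (suc w + v + mz + mo) → b + (mz + mo) ≤ capacity w v mz mo
capacity-fits w v mz mo b noOverlap budget =
  +-cancelˡ-≤ (v + mo) _ _ (+-cancelʳ-≤ (tri (suc c)) _ _ (begin
    (v + mo) + (b + c) + tri (suc c) ≡⟨ regroup (v + mo) b c (tri (suc c)) ⟩
    (v + mo) + b + tri (suc c) + c   ≤⟨ +-monoˡ-≤ c budget ⟩
    tri (suc w + v + mz + mo) + c    ≡⟨ capacity-identity w v mz mo ⟨
    (v + mo) + capacity w v mz mo + mo * w + tri (suc c)
      ≡⟨ cong (λ x → (v + mo) + capacity w v mz mo + x + tri (suc c)) noOverlap ⟩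
    (v + mo) + capacity w v mz mo + 0 + tri (suc c)
      ≡⟨ cong (_+ tri (suc c)) (+-identityʳ ((v + mo) + capacity w v mz mo)) ⟩
    (v + mo) + capacity w v mz mo + tri (suc c) ∎))
  where
    c = mz + mo
    open ≤-Reasoning
    regroup : ∀ α b c x → α + (b + c) + x ≡ α + b + x + c
    regroup = solve-∀

record Shape (t α c : ℕ) : Set where
  constructor shapeOf
  field
    w v mz mo  : ℕ
    size≡      : suc w + v + mz + mo ≡ t
    highs≡     : v + mo ≡ α
    marks≡     : mz + mo ≡ c
    free-high  : v ≡ 0 → mo ≡ 0
    no-overlap : mo * w ≡ 0

fewHighs⇒≤ : ∀ {α t} → α + 2 ≤ suc t ⊎ α ≡ 0 → α ≤ t
fewHighs⇒≤ {α} {t} (inj₁ α+2≤) = ≤-trans (n≤1+n α) (≤-pred (subst (_≤ suc t) (+-comm α 2) α+2≤))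
fewHighs⇒≤         (inj₂ refl) = z≤n

-- If there is room for all high rows and marks beside a free bottom row,
-- all marks are low; otherwise the bottom row is the only free low row and
-- the surplus of high rows is marked.
choose-shape : ∀ t α c b → 1 ≤ t → α + 2 ≤ t ⊎ α ≡ 0 → α + b + tri (suc c) ≤ tri t → Shape t α c
choose-shape (suc t) α c b _ fewHighs budget with α + c ≤? t
... | yes room = shapeOf w α c 0 (cong suc (trans (regroup w α c) w≡)) (+-identityʳ α) (+-identityʳ c) (λ _ → refl) refl
  where
    w = proj₁ (m≤n⇒∃[o]m+o≡n room)
    w≡ = proj₂ (m≤n⇒∃[o]m+o≡n room)
    regroup : ∀ w α c → w + α + c + 0 ≡ α + c + w
    regroup = solve-∀
... | no crowded = shapeOf 0 v mz mo (cong suc size≡t) v+mo≡α mz+mo≡c (λ v≡0 → ⊥-elim (<⇒≢ c<t (trans (sym (+-identityʳ c)) (trans (cong (_+_ c) (sym v≡0)) c+v≡t)))) (*-zeroʳ mo)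
  where
    t<α+c = ≰⇒> crowded
    c≤t : c ≤ t
    c≤t = tri-reflect c t (≤-trans (m≤n+m (tri (suc c)) (α + b)) budget)
    α≤t : α ≤ t
    α≤t = fewHighs⇒≤ fewHighs
    c<t : c < t
    c<t with m≤n⇒m<n∨m≡n c≤t
    ... | inj₁ c<t = c<t
    ... | inj₂ refl = ⊥-elim (<-irrefl refl (≤-trans t<α+c (≤-reflexive (cong (_+ c) α≡0))))
      where
        α≡0 : α ≡ 0
        α≡0 = n≤0⇒n≡0 (≤-trans (m≤m+n α b) (+-cancelʳ-≤ (tri (suc c)) (α + b) 0 budget))
    v = proj₁ (m≤n⇒∃[o]m+o≡n c≤t)
    c+v≡t = proj₂ (m≤n⇒∃[o]m+o≡n c≤t)
    v≤α : v ≤ α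
    v≤α = <⇒≤ (+-cancelʳ-< c v α (subst (_< α + c) (trans (sym c+v≡t) (+-comm c v)) t<α+c))
    mo = proj₁ (m≤n⇒∃[o]m+o≡n v≤α)
    v+mo≡α = proj₂ (m≤n⇒∃[o]m+o≡n v≤α)
    mo≤c : mo ≤ c
    mo≤c = +-cancelˡ-≤ v mo c (≤-trans (≤-reflexive v+mo≡α) (≤-trans α≤t (≤-reflexive (trans (sym c+v≡t) (+-comm c v)))))
    mz = proj₁ (m≤n⇒∃[o]m+o≡n mo≤c)
    mz+mo≡c = trans (+-comm mz mo) (proj₂ (m≤n⇒∃[o]m+o≡n mo≤c))
    size≡t : 0 + v + mz + mo ≡ t
    size≡t = trans (+-assoc v mz mo) (trans (cong (_+_ v) mz+mo≡c) (trans (+-comm v c) c+v≡t))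

size-length : ∀ R → size (profileOf R) ≡ length R
size-length []      = refl
size-length (r ∷ R) = trans (+-comm (size (profileOf R)) 1) (cong suc (size-length R))

tower-exists : ∀ t α c b → 1 ≤ t → α + 2 ≤ t ⊎ α ≡ 0 → α + b + tri (suc c) ≤ tri t →
  Σ (List Row) λ R → Valid R × length R ≡ t × highs (profileOf R) ≡ α × marks (profileOf R) ≡ c × pairs (profileOf R) ≡ b + c
tower-exists t α c b 1≤t fewHighs budget with choose-shape t α c b 1≤t fewHighs budget
... | shapeOf w v mz mo refl refl refl free-high no-overlap
  with two-lanes w v mz mo (b + (mz + mo)) free-high (m≤n+m (mz + mo) b) (capacity-fits w v mz mo b no-overlap budget)
... | R , valid , prof =
  R , valid , trans (sym (size-length R)) (cong size prof) , cong highs prof , cong marks prof , cong pairs prof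

tower-budget : ∀ {n a} b c (s : AreaSplit n a) → let open AreaSplit s in
               a + b + tri (suc c) ≤ tri n → α + b + tri (suc c) ≤ tri t
tower-budget b c (areaSplit p t α refl _ refl _) budget =
  +-cancelˡ-≤ (tri p + p * t) _ _ (begin
    tri p + p * t + (α + b + tri (suc c)) ≡⟨ regroup (tri p + p * t) α b (tri (suc c)) ⟩
    tri p + p * t + α + b + tri (suc c)   ≤⟨ budget ⟩
    tri (p + t)                           ≡⟨ tri-add p t ⟩
    tri p + tri t + p * t                 ≡⟨ swap (tri p) (tri t) (p * t) ⟩
    tri p + p * t + tri t                 ∎)
  where
    open ≤-Reasoning
    regroup : ∀ x α b y → x + (α + b + y) ≡ x + α + b + y
    regroup = solve-∀
    swap : ∀ x y z → x + y + z ≡ x + z + y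
    swap = solve-∀

MPFWith : ℕ → ℕ → ℕ → ℕ → Set
MPFWith n a b c = Σ (MPF n) (λ M → area M ≡ a × dinv M ≡ + b × numMarked M ≡ c)

dinv-arith : ∀ b c → + (b + c) -ℤ + c ≡ + b
dinv-arith b c = trans (ℤ.[+m]-[+n]≡m⊖n (b + c) c) (trans (ℤ.⊖-≥ (m≤n+m c b)) (cong +_ (m+n∸n≡m b c)))

staircase-with-tower : ∀ p {t α c} b R → Valid R → length R ≡ t → highs (profileOf R) ≡ α →
  marks (profileOf R) ≡ c → pairs (profileOf R) ≡ b + c → MPFWith (t + p) (tri p + p * t + α) b c
staircase-with-tower p b R valid refl refl refl pairs≡ with tower-MPF p R valid
... | M , area≡ , inversions≡ , marks≡ =
  M , trans area≡ (sym (+-assoc (tri p) _ _))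
    , trans (cong₂ (λ x y → + x -ℤ + y) (trans inversions≡ pairs≡) marks≡) (dinv-arith b (marks (profileOf R)))
    , marks≡

budget-tri : ∀ n a b c → a + b + (suc c) C 2 ≤ n C 2 → a + b + tri (suc c) ≤ tri n
budget-tri n a b c = subst₂ (λ x y → a + b + x ≤ y) (C2≡tri (suc c)) (C2≡tri n)

theorem4p8 : (n a b c : ℕ) → 1 ≤ n → a + b + (suc c) C 2 ≤ n C 2 →
    Σ (MPF n) (λ M → area M ≡ a × dinv M ≡ + b × numMarked M ≡ c)
theorem4p8 zero    a b c () _
theorem4p8 (suc n) a b c _ hypothesis = from-split (area-split n a area≤)
  where
    budget : a + b + tri (suc c) ≤ tri (suc n)
    budget = budget-tri (suc n) a b c hypothesis

    area≤ : a ≤ tri (suc n)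
    area≤ = ≤-trans (≤-trans (m≤m+n a b) (m≤m+n (a + b) _)) budget

    from-split : AreaSplit (suc n) a → MPFWith (suc n) a b c
    from-split split@(areaSplit p t α p+t≡n 1≤t area≡ fewHighs)
      with tower-exists t α c b 1≤t fewHighs (tower-budget b c split budget)
    ... | R , valid , length≡ , highs≡ , marks≡ , pairs≡ =
      subst₂ (λ m a′ → MPFWith m a′ b c) (trans (+-comm t p) p+t≡n) (sym area≡)
             (staircase-with-tower p b R valid length≡ highs≡ marks≡ pairs≡)
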